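{- Let $a_1,a_2\geq2$ be integers and let $A_0\subseteq [a_1]\times [a_2]$ with $|A_0|=\frac{a_1a_2+a_1+a_2}{3}$. If $A_0$ percolates under the $3$-neighbour process in the grid $[a_1]\times [a_2]$, then (1) $A_0$ is an independent set; (2) every even boundary vertex is contained in $A_0$; (3) $a_1$ and $a_2$ are both odd; (4) every connected component of the subgraph induced by $([a_1]\times [a_2])\setminus A_0$ is a tree containing exactly one boundary vertex; and (5) every $v\in A_0$ is even.
   Context: The $3$-neighbour bootstrap process in a graph $G$ starts from $A_0\subseteq V(G)$ and, for $t\ge1$, sets $A_t=A_{t-1}\cup\{v: |N_G(v)\cap A_{t-1}|\ge 3\}$; $A_0$ percolates if $\bigcup_t A_t=V(G)$. The grid $[a_1]\times[a_2]$ (with $[n]=\{1,\dots,n\}$) has vertex set $[a_1]\times[a_2]$, two vertices adjacent iff they differ by exactly $1$ in exactly one coordinate and agree in the other. A vertex $(v_1,v_2)$ is a boundary vertex if $v_1\in\{1,a_1\}$ or $v_2\in\{1,a_2\}$. A vertex $(v_1,v_2)$ is even if $v_1+v_2$ is even and odd otherwise. -}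

module Defs where

open import Data.Nat using (ℕ; zero; suc; _+_; _*_; _≤_; _≡ᵇ_; _∸_)
open import Data.Bool using (Bool; true; false; _∨_; _∧_; not; if_then_else_)
open import Data.Fin using (Fin; toℕ)
open import Data.Nat.ListAction using (sum)
open import Data.List using (List; []; _∷_; _++_; [_]; length; map; cartesianProduct; allFin)
open import Data.List.Membership.Propositional using (_∈_)
open import Data.List.Relation.Unary.All using (All)
open import Data.List.Relation.Unary.Unique.Propositional using (Unique)
open import Data.Product using (_×_; _,_; ∃)
open import Data.Unit using (⊤)
open import Data.Nat using (_<ᵇ_)
open import Relation.Binary.PropositionalEquality using (_≡_)
open import Relation.Nullary using (¬_)
open import Data.Nat.Divisibility using (_∣_)
open import Data.Sum using (_⊎_)

-- Vertices of the grid [a₁]×[a₂], 0-indexed: (i , j) stands for (i+1 , j+1).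
V : ℕ → ℕ → Set
V a₁ a₂ = Fin a₁ × Fin a₂

VSet : ℕ → ℕ → Set
VSet a₁ a₂ = V a₁ a₂ → Bool

vertices : (a₁ a₂ : ℕ) → List (V a₁ a₂)
vertices a₁ a₂ = cartesianProduct (allFin a₁) (allFin a₂)

count : {a₁ a₂ : ℕ} → (V a₁ a₂ → Bool) → ℕ
count {a₁} {a₂} P = sum (map (λ v → if P v then 1 else 0) (vertices a₁ a₂))

card : {a₁ a₂ : ℕ} → VSet a₁ a₂ → ℕ
card A = count A

diff1 : ℕ → ℕ → Bool
diff1 m n = (suc m ≡ᵇ n) ∨ (suc n ≡ᵇ m)

adj : {a₁ a₂ : ℕ} → V a₁ a₂ → V a₁ a₂ → Bool
adj (i , j) (k , l) =
  ((toℕ i ≡ᵇ toℕ k) ∧ diff1 (toℕ j) (toℕ l)) ∨ ((toℕ j ≡ᵇ toℕ l) ∧ diff1 (toℕ i) (toℕ k))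

Adj : {a₁ a₂ : ℕ} → V a₁ a₂ → V a₁ a₂ → Set
Adj u v = adj u v ≡ true

nbrCount : {a₁ a₂ : ℕ} → VSet a₁ a₂ → V a₁ a₂ → ℕ
nbrCount A v = count (λ w → adj v w ∧ A w)

step : {a₁ a₂ : ℕ} → VSet a₁ a₂ → VSet a₁ a₂
step A v = A v ∨ (2 <ᵇ nbrCount A v)

bootstrap : {a₁ a₂ : ℕ} → VSet a₁ a₂ → ℕ → VSet a₁ a₂
bootstrap A zero = A
bootstrap A (suc t) = step (bootstrap A t)

Percolates : {a₁ a₂ : ℕ} → VSet a₁ a₂ → Set
Percolates {a₁} {a₂} A = (v : V a₁ a₂) → ∃ λ t → bootstrap A t v ≡ true

_∈ˢ_ : {a₁ a₂ : ℕ} → V a₁ a₂ → VSet a₁ a₂ → Set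
v ∈ˢ A = A v ≡ true

Independent : {a₁ a₂ : ℕ} → VSet a₁ a₂ → Set
Independent {a₁} {a₂} A = (u v : V a₁ a₂) → u ∈ˢ A → v ∈ˢ A → ¬ Adj u v

-- boundary vertex (1-indexed coordinate 1 or a_i, i.e. 0-indexed 0 or a_i - 1)
Boundary : {a₁ a₂ : ℕ} → V a₁ a₂ → Set
Boundary {a₁} {a₂} (i , j) =
  (toℕ i ≡ 0) ⊎ (toℕ i ≡ a₁ ∸ 1) ⊎ (toℕ j ≡ 0) ⊎ (toℕ j ≡ a₂ ∸ 1)

-- even vertex: v₁ + v₂ even (1-indexed (i+1)+(j+1) has the same parity as i+j)
Even : {a₁ a₂ : ℕ} → V a₁ a₂ → Set
Even (i , j) = 2 ∣ (toℕ i + toℕ j)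

OddNat : ℕ → Set
OddNat n = ¬ (2 ∣ n)

compl : {a₁ a₂ : ℕ} → VSet a₁ a₂ → VSet a₁ a₂
compl A v = not (A v)

data Reach {a₁ a₂ : ℕ} (S : VSet a₁ a₂) (u : V a₁ a₂) : V a₁ a₂ → Set where
  here : u ∈ˢ S → Reach S u u
  there : {w x : V a₁ a₂} → Reach S u w → x ∈ˢ S → Adj w x → Reach S u x

-- vertex set of the connected component of the induced subgraph G[S] containing u
-- (u ∈ S is assumed where used)
InComp : {a₁ a₂ : ℕ} → VSet a₁ a₂ → V a₁ a₂ → V a₁ a₂ → Set
InComp S u w = Reach S u w

Walk : {a₁ a₂ : ℕ} → List (V a₁ a₂) → Set
Walk [] = ⊤
Walk (x ∷ []) = ⊤
Walk (x ∷ y ∷ rest) = Adj x y × Walk (y ∷ rest)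

IsCycle : {a₁ a₂ : ℕ} → V a₁ a₂ → List (V a₁ a₂) → Set
IsCycle x xs = (2 ≤ length xs) × Unique (x ∷ xs) × Walk (x ∷ xs ++ [ x ])

-- the component C of G[S] containing u (u ∈ S) is a tree: it is connected by
-- construction, and it contains no cycle (the induced subgraph G[C] is acyclic).
CompIsTree : {a₁ a₂ : ℕ} → VSet a₁ a₂ → V a₁ a₂ → Set
CompIsTree {a₁} {a₂} S u =
  (x : V a₁ a₂) (xs : List (V a₁ a₂)) → IsCycle x xs →
  ¬ All (InComp S u) (x ∷ xs)

CompOneBoundary : {a₁ a₂ : ℕ} → VSet a₁ a₂ → V a₁ a₂ → Set
CompOneBoundary {a₁} {a₂} S u =
  ∃ λ (b : V a₁ a₂) → InComp S u b × Boundary b ×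
    ((b′ : V a₁ a₂) → InComp S u b′ → Boundary b′ → b′ ≡ b)

-- Let time v be the step at which v gets infected.  A vertex outside A₀ has
-- at least three earlier neighbours, so at least 3 |V ∖ A₀| edges join
-- vertices infected at different times; by the size assumption this is the
-- number of all edges.  Hence adjacent vertices are infected at different
-- times and a vertex outside A₀ has exactly (degree − 3) later neighbours:
-- one inside the grid, none on the boundary, and the corners lie in A₀.
-- The earliest vertex of a cycle outside A₀ would have two later
-- neighbours, and following later neighbours leads from a vertex outside A₀
-- to the only boundary vertex of its component.  Along each side A₀
-- alternates, starting from a corner.  Finally, colour every unit square by
-- the parity of its A₀-vertices: the boundary squares are even, and a wall
-- between odd and even squares would pass through vertices outside A₀ and
-- always continue to an earlier vertex, which is impossible.
module Submission where

open import Data.Bool using (Bool; true; false; _∨_; _∧_; not; _xor_; if_then_else_; T)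
import Data.Bool.Properties as BoolP
open BoolP using (T-≡; T-∨; T-∧)
open import Data.Empty using (⊥; ⊥-elim)
open import Data.Fin as Fin using (Fin; toℕ; fromℕ<)
open import Data.Fin.Properties using (toℕ-fromℕ<; fromℕ<-toℕ; toℕ-injective; toℕ<n)
open import Data.List using (List; []; _∷_; _++_; [_]; map; length; cartesianProduct; allFin; tabulate)
open import Data.List.Membership.Propositional using (_∈_)
open import Data.List.Membership.Propositional.Properties using (∈-++⁺ʳ; ∈-cartesianProduct⁺; ∈-allFin)
open import Data.List.Properties using (length-tabulate)
open import Data.List.Relation.Unary.All as All using (All; []; _∷_)
open import Data.List.Relation.Unary.AllPairs using (_∷_)
open import Data.List.Relation.Unary.Any as Any using (here; there; any?)
open import Data.List.Relation.Unary.Linked as Linked using (Linked; []; [-]; _∷_)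
open import Data.List.Relation.Unary.Linked.Properties using (Linked⇒AllPairs)
open import Data.List.Relation.Unary.Unique.Propositional using (Unique)
import Data.List.Relation.Unary.Unique.Propositional.Properties as Unique
open import Data.Nat using (ℕ; zero; suc; _+_; _*_; _∸_; _≤_; _<_; _≡ᵇ_; _<ᵇ_; z≤n; s≤s)
open import Data.Nat.Divisibility using (_∣_; divides)
open import Data.Nat.ListAction using (sum)
import Data.Nat.Properties as ℕ
open import Data.Nat.Tactic.RingSolver using (solve-∀)
open import Data.Product using (_×_; _,_; proj₁; proj₂; ∃; ∃₂; Σ)
open import Data.Product.Properties using (≡-dec)
open import Data.Sum using (_⊎_; inj₁; inj₂; [_,_]′)
open import Function using (id; _∘_; Equivalence; flip)
open import Relation.Binary using (tri<; tri≈; tri>)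
open import Relation.Binary.PropositionalEquality hiding ([_])
open import Relation.Nullary using (¬_; Dec; yes; no)
open import Relation.Nullary.Decidable using (_×-dec_; _⊎-dec_)

open import Defs

open import Algebra.Properties.CommutativeSemigroup ℕ.+-commutativeSemigroup
  using () renaming (interchange to +-interchange)
open Equivalence using (to; from)

≡true⇒T : ∀ {b} → b ≡ true → T b
≡true⇒T = from T-≡

T⇒≡true : ∀ {b} → T b → b ≡ true
T⇒≡true = to T-≡

last-below : ∀ {m n} → m < n → n ≤ suc m → m ≡ n ∸ 1
last-below m<n n≤ = cong (_∸ 1) (ℕ.≤-antisym m<n n≤)

<ᵇ-false : ∀ {m n} → n ≤ m → (m <ᵇ n) ≡ false
<ᵇ-false {m} {n} n≤m with m <ᵇ n in e
... | true  = ⊥-elim (ℕ.≤⇒≯ n≤m (ℕ.<ᵇ⇒< m n (≡true⇒T e)))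
... | false = refl

false≢true : false ≢ true
false≢true ()

first-change : ∀ (f : ℕ → Bool) n → f 0 ≡ false → f n ≡ true → ∃ λ k → k < n × f k ≢ f (suc k)
first-change f zero    f0 fn = ⊥-elim (false≢true (trans (sym f0) fn))
first-change f (suc n) f0 fn with f n in e
... | false = n , ℕ.n<1+n n , λ eq → false≢true (trans (sym e) (trans eq fn))
... | true with first-change f n f0 e
...   | k , k<n , ne = k , ℕ.m<n⇒m<1+n k<n , ne

-- least f n is the least t with f t, provided that f n holds.
least : (ℕ → Bool) → ℕ → ℕ
least f zero    = 0
least f (suc n) = if f 0 then 0 else suc (least (f ∘ suc) n)

least-true : ∀ (f : ℕ → Bool) n → f n ≡ true → f (least f n) ≡ true
least-true f zero    fn = fn
least-true f (suc n) fn with f 0 in e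
... | true  = e
... | false = least-true (f ∘ suc) n fn

least-minimal : ∀ (f : ℕ → Bool) n m → m < least f n → f m ≡ false
least-minimal f (suc n) m m< with f 0 in e
least-minimal f (suc n) zero    _         | false = e
least-minimal f (suc n) (suc m) (s≤s m<) | false = least-minimal (f ∘ suc) n m m<

double-squeeze : ∀ {e q h} → h ≤ e → e + e + q ≤ 2 * h → q ≡ 0 × e ≡ h
double-squeeze {e} {q} {h} h≤e e+e+q≤2h = ℕ.n≤0⇒n≡0 q≤0 , ℕ.≤-antisym e≤h h≤e
  where
  2h≤e+e : 2 * h ≤ e + e
  2h≤e+e = subst (2 * h ≤_) (cong (e +_) (ℕ.+-identityʳ e)) (ℕ.*-monoʳ-≤ 2 h≤e)
  q≤0 : q ≤ 0
  q≤0 = ℕ.+-cancelˡ-≤ (e + e) q 0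
          (subst (e + e + q ≤_) (sym (ℕ.+-identityʳ (e + e))) (ℕ.≤-trans e+e+q≤2h 2h≤e+e))
  e≤h : e ≤ h
  e≤h = ℕ.*-cancelˡ-≤ 2 (subst (_≤ 2 * h) (cong (e +_) (sym (ℕ.+-identityʳ e)))
                           (ℕ.≤-trans (ℕ.m≤m+n (e + e) q) e+e+q≤2h))

-- The hypothesis says 3h = 2ab − a − b, the number of edges of the a × b
-- grid; the left-hand side of the conclusion counts each edge twice.
grid-edges : ∀ a b h → 0 < a → 0 < b → 3 * h + (a * b + a + b) ≡ 3 * (a * b) →
             b * ((a ∸ 1) + (a ∸ 1)) + a * ((b ∸ 1) + (b ∸ 1)) ≡ 2 * (3 * h)
grid-edges (suc p) (suc q) h _ _ e = ℕ.+-cancelʳ-≡ k _ _ (begin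
  suc q * (p + p) + suc p * (q + q) + k ≡⟨ shift p q ⟩
  2 * (3 * (suc p * suc q))             ≡⟨ cong (2 *_) e ⟨
  2 * (3 * h + k′)                      ≡⟨ ℕ.*-distribˡ-+ 2 (3 * h) k′ ⟩
  2 * (3 * h) + k                       ∎)
  where
  open ≡-Reasoning
  k′ k : ℕ
  k′ = suc p * suc q + suc p + suc q
  k  = 2 * k′
  shift : ∀ p q → suc q * (p + p) + suc p * (q + q) + 2 * (suc p * suc q + suc p + suc q) ≡
                  2 * (3 * (suc p * suc q))
  shift = solve-∀

isEven : ℕ → Bool
isEven zero          = true
isEven (suc zero)    = false
isEven (suc (suc n)) = isEven n

isEven-suc : ∀ n → isEven (suc n) ≡ not (isEven n)
isEven-suc zero          = refl
isEven-suc (suc zero)    = refl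
isEven-suc (suc (suc n)) = isEven-suc n

isEven-+ : ∀ m n → isEven m ≡ true → isEven (m + n) ≡ isEven n
isEven-+ zero          n _ = refl
isEven-+ (suc (suc m)) n e = isEven-+ m n e

isEven⇒2∣ : ∀ n → isEven n ≡ true → 2 ∣ n
isEven⇒2∣ zero _ = divides 0 refl
isEven⇒2∣ (suc (suc n)) e with isEven⇒2∣ n e
... | divides q n≡q*2 = divides (suc q) (cong (suc ∘ suc) n≡q*2)

2∣⇒isEven : ∀ n → 2 ∣ n → isEven n ≡ true
2∣⇒isEven n (divides q refl) = even-double q
  where
  even-double : ∀ q → isEven (q * 2) ≡ true
  even-double zero    = refl
  even-double (suc q) = even-double q

isEven-+suc : ∀ m n → isEven (m + suc n) ≡ not (isEven (m + n))
isEven-+suc m n = trans (cong isEven (ℕ.+-suc m n)) (isEven-suc (m + n))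

odd-if-pred-even : ∀ n → 0 < n → isEven (n ∸ 1) ≡ true → OddNat n
odd-if-pred-even (suc n) _ e 2∣ =
  false≢true (trans (sym (trans (isEven-suc n) (cong not e))) (2∣⇒isEven (suc n) 2∣))

bit : Bool → ℕ
bit b = if b then 1 else 0

bit-pos : ∀ {b} → 0 < bit b → b ≡ true
bit-pos {true} _ = refl

bit-∨ : ∀ b c → bit (b ∨ c) ≤ bit b + bit c
bit-∨ true  c = s≤s z≤n
bit-∨ false c = ℕ.≤-refl

bit≤1 : ∀ b → bit b ≤ 1
bit≤1 true  = s≤s z≤n
bit≤1 false = z≤n

∑ : {A : Set} → List A → (A → ℕ) → ℕ
∑ L f = sum (map f L)

module _ {A : Set} where

  ∑-cong : ∀ (L : List A) {f g : A → ℕ} → (∀ x → f x ≡ g x) → ∑ L f ≡ ∑ L g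
  ∑-cong []      f≡g = refl
  ∑-cong (x ∷ L) f≡g = cong₂ _+_ (f≡g x) (∑-cong L f≡g)

  ∑-mono-≤ : ∀ (L : List A) {f g : A → ℕ} → (∀ x → f x ≤ g x) → ∑ L f ≤ ∑ L g
  ∑-mono-≤ []      f≤g = z≤n
  ∑-mono-≤ (x ∷ L) f≤g = ℕ.+-mono-≤ (f≤g x) (∑-mono-≤ L f≤g)

  ∑-+ : ∀ (L : List A) (f g : A → ℕ) → ∑ L (λ x → f x + g x) ≡ ∑ L f + ∑ L g
  ∑-+ []      f g = refl
  ∑-+ (x ∷ L) f g = trans (cong (f x + g x +_) (∑-+ L f g)) (+-interchange (f x) (g x) (∑ L f) (∑ L g))

  ∑-++ : ∀ (L M : List A) (f : A → ℕ) → ∑ (L ++ M) f ≡ ∑ L f + ∑ M f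
  ∑-++ []      M f = refl
  ∑-++ (x ∷ L) M f = trans (cong (f x +_) (∑-++ L M f)) (sym (ℕ.+-assoc (f x) _ _))

  ∑-const : ∀ (L : List A) c → ∑ L (λ _ → c) ≡ length L * c
  ∑-const []      c = refl
  ∑-const (x ∷ L) c = cong (c +_) (∑-const L c)

  ∑-*ˡ : ∀ (L : List A) c (f : A → ℕ) → ∑ L (λ x → c * f x) ≡ c * ∑ L f
  ∑-*ˡ []      c f = sym (ℕ.*-zeroʳ c)
  ∑-*ˡ (x ∷ L) c f = trans (cong (c * f x +_) (∑-*ˡ L c f)) (sym (ℕ.*-distribˡ-+ c (f x) _))

  ∈⇒≤∑ : ∀ {L : List A} (f : A → ℕ) {x} → x ∈ L → f x ≤ ∑ L f
  ∈⇒≤∑ {y ∷ L} f (here refl) = ℕ.m≤m+n (f y) _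
  ∈⇒≤∑ {y ∷ L} f (there x∈) = ℕ.≤-trans (∈⇒≤∑ f x∈) (ℕ.m≤n+m _ (f y))

  ∈₂⇒≤∑ : ∀ {L : List A} (f : A → ℕ) {x y} → x ∈ L → y ∈ L → x ≢ y → f x + f y ≤ ∑ L f
  ∈₂⇒≤∑ {z ∷ L} f (here refl) (here refl) x≢y = ⊥-elim (x≢y refl)
  ∈₂⇒≤∑ {z ∷ L} f (here refl) (there y∈) _ = ℕ.+-monoʳ-≤ (f z) (∈⇒≤∑ f y∈)
  ∈₂⇒≤∑ {z ∷ L} f {x} {y} (there x∈) (here refl) _ =
    subst (_≤ f z + ∑ L f) (ℕ.+-comm (f y) (f x)) (ℕ.+-monoʳ-≤ (f z) (∈⇒≤∑ f x∈))
  ∈₂⇒≤∑ {z ∷ L} f (there x∈) (there y∈) x≢y = ℕ.≤-trans (∈₂⇒≤∑ f x∈ y∈ x≢y) (ℕ.m≤n+m _ (f z))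

  ∑-pos⇒∃ : ∀ (L : List A) (f : A → ℕ) → 0 < ∑ L f → ∃ λ x → x ∈ L × 0 < f x
  ∑-pos⇒∃ (x ∷ L) f pos with f x in e
  ... | suc _ = x , here refl , subst (0 <_) (sym e) (s≤s z≤n)
  ... | zero with ∑-pos⇒∃ L f pos
  ...   | y , y∈ , fy>0 = y , there y∈ , fy>0

  ∑-zero : ∀ (L : List A) (f : A → ℕ) → (∀ x → x ∈ L → f x ≡ 0) → ∑ L f ≡ 0
  ∑-zero []      f f≡0 = refl
  ∑-zero (x ∷ L) f f≡0 = cong₂ _+_ (f≡0 x (here refl)) (∑-zero L f (λ y → f≡0 y ∘ there))

  ∑-≤1 : ∀ (L : List A) (f : A → ℕ) → Unique L → (∀ x → f x ≤ 1) →
         (∀ x y → 0 < f x → 0 < f y → x ≡ y) → ∑ L f ≤ 1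
  ∑-≤1 []      f _ _ _ = z≤n
  ∑-≤1 (x ∷ L) f (x∉L ∷ uL) f≤1 inj with f x in e
  ... | zero  = ∑-≤1 L f uL f≤1 inj
  ... | suc _ = ℕ.+-mono-≤ (subst (_≤ 1) e (f≤1 x)) (ℕ.≤-reflexive rest≡0)
    where
    rest≡0 : ∑ L f ≡ 0
    rest≡0 = ∑-zero L f λ y y∈ → ℕ.n≤0⇒n≡0 (ℕ.≮⇒≥ λ fy>0 →
      All.lookup x∉L y∈ (inj x y (subst (0 <_) (sym e) (s≤s z≤n)) fy>0))

  ∑-squeeze : ∀ (L : List A) {f g : A → ℕ} → (∀ x → f x ≤ g x) → ∑ L g ≤ ∑ L f →
              ∀ {x} → x ∈ L → f x ≡ g x
  ∑-squeeze (y ∷ L) {f} {g} f≤g ≥ = λ where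
      (here refl) → fy≡gy
      (there x∈)  → ∑-squeeze L f≤g rest x∈
    where
    fy≡gy : f y ≡ g y
    fy≡gy = ℕ.≤-antisym (f≤g y) (ℕ.+-cancelʳ-≤ (∑ L g) (g y) (f y)
              (ℕ.≤-trans ≥ (ℕ.+-monoʳ-≤ (f y) (∑-mono-≤ L f≤g))))
    rest : ∑ L g ≤ ∑ L f
    rest = ℕ.+-cancelˡ-≤ (g y) (∑ L g) (∑ L f) (subst (λ t → g y + ∑ L g ≤ t + ∑ L f) fy≡gy ≥)

∑-map : ∀ {A B : Set} (L : List A) (g : A → B) (f : B → ℕ) → ∑ (map g L) f ≡ ∑ L (f ∘ g)
∑-map []      g f = refl
∑-map (x ∷ L) g f = cong (f (g x) +_) (∑-map L g f)

module _ {A B : Set} where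

  ∑-swap : ∀ (L : List A) (M : List B) (f : A → B → ℕ) →
           ∑ L (λ x → ∑ M (f x)) ≡ ∑ M (λ y → ∑ L (λ x → f x y))
  ∑-swap []      M f = sym (trans (∑-const M 0) (ℕ.*-zeroʳ (length M)))
  ∑-swap (x ∷ L) M f = trans (cong (∑ M (f x) +_) (∑-swap L M f)) (sym (∑-+ M (f x) _))


  ∑-cartesianProduct : ∀ (L : List A) (M : List B) (f : A × B → ℕ) →
                       ∑ (cartesianProduct L M) f ≡ ∑ L (λ x → ∑ M (λ y → f (x , y)))
  ∑-cartesianProduct []      M f = refl
  ∑-cartesianProduct (x ∷ L) M f =
    trans (∑-++ (map (x ,_) M) _ f) (cong₂ _+_ (∑-map M (x ,_) f) (∑-cartesianProduct L M f))

∑< : ℕ → (ℕ → ℕ) → ℕ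
∑< zero    h = 0
∑< (suc n) h = h 0 + ∑< n (h ∘ suc)

∑<-+ : ∀ n (f g : ℕ → ℕ) → ∑< n (λ x → f x + g x) ≡ ∑< n f + ∑< n g
∑<-+ zero    f g = refl
∑<-+ (suc n) f g = trans (cong (f 0 + g 0 +_) (∑<-+ n (f ∘ suc) (g ∘ suc)))
                         (+-interchange (f 0) (g 0) (∑< n (f ∘ suc)) (∑< n (g ∘ suc)))

∑<-const : ∀ n c → ∑< n (λ _ → c) ≡ n * c
∑<-const zero    c = refl
∑<-const (suc n) c = cong (c +_) (∑<-const n c)

lineDegree : ℕ → ℕ → ℕ
lineDegree a x = bit (0 <ᵇ x) + bit (suc x <ᵇ a)

∑<-lineDegree : ∀ a → ∑< a (lineDegree a) ≡ (a ∸ 1) + (a ∸ 1)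
∑<-lineDegree a = trans (∑<-+ a _ _) (cong₂ _+_ (left-ends a) (right-ends a))
  where
  left-ends : ∀ a → ∑< a (λ x → bit (0 <ᵇ x)) ≡ a ∸ 1
  left-ends zero    = refl
  left-ends (suc a) = trans (∑<-const a 1) (ℕ.*-identityʳ a)
  right-ends : ∀ a → ∑< a (λ x → bit (suc x <ᵇ a)) ≡ a ∸ 1
  right-ends zero          = refl
  right-ends (suc zero)    = refl
  right-ends (suc (suc a)) = cong suc (right-ends (suc a))

lineDegree≤2 : ∀ a x → lineDegree a x ≤ 2
lineDegree≤2 a x = ℕ.+-mono-≤ (bit≤1 (0 <ᵇ x)) (bit≤1 (suc x <ᵇ a))

lineDegree-end : ∀ a x → x ≡ 0 ⊎ x ≡ a ∸ 1 → x < a → lineDegree a x ≤ 1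
lineDegree-end a x (inj₁ refl) _ = bit≤1 (1 <ᵇ a)
lineDegree-end (suc a) x (inj₂ refl) _ =
  subst (λ b → bit (0 <ᵇ a) + bit b ≤ 1) (sym (<ᵇ-false {suc a} {suc a} ℕ.≤-refl))
        (subst (_≤ 1) (sym (ℕ.+-identityʳ _)) (bit≤1 (0 <ᵇ a)))

lineDegree-inner : ∀ a x → x ≢ 0 → x ≢ a ∸ 1 → x < a → 2 ≤ lineDegree a x
lineDegree-inner a zero    x≢0 _ _ = ⊥-elim (x≢0 refl)
lineDegree-inner a (suc x) _ x≢a-1 x<a with ℕ.m≤n⇒m<n∨m≡n x<a
... | inj₁ x+1<a = ℕ.+-monoʳ-≤ 1 (ℕ.≤-reflexive (sym (cong bit (T⇒≡true (ℕ.<⇒<ᵇ x+1<a)))))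
... | inj₂ refl  = ⊥-elim (x≢a-1 refl)

∑-allFin : ∀ n (h : ℕ → ℕ) → ∑ (allFin n) (h ∘ toℕ) ≡ ∑< n h
∑-allFin n h = ∑-tabulate n id h refl
  where
  ∑-tabulate : ∀ n {A : Set} (f : Fin n → A) (h : ℕ → ℕ) {g : A → ℕ} →
               (∀ {i} → g (f i) ≡ h (toℕ i)) → ∑ (tabulate f) g ≡ ∑< n h
  ∑-tabulate zero    f h g∘f≡h = refl
  ∑-tabulate (suc n) f h g∘f≡h = cong₂ _+_ g∘f≡h (∑-tabulate n (f ∘ Fin.suc) (h ∘ suc) g∘f≡h)

_∼_ : ℕ → ℕ → Set
m ∼ n = suc m ≡ n ⊎ suc n ≡ m

∼-sym : ∀ {m n} → m ∼ n → n ∼ m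
∼-sym = [ inj₂ , inj₁ ]′

GridAdj : ℕ × ℕ → ℕ × ℕ → Set
GridAdj (x , y) (x′ , y′) = (x ≡ x′ × y ∼ y′) ⊎ (y ≡ y′ × x ∼ x′)

GridAdj-sym : ∀ {p q} → GridAdj p q → GridAdj q p
GridAdj-sym (inj₁ (e , d)) = inj₁ (sym e , ∼-sym d)
GridAdj-sym (inj₂ (e , d)) = inj₂ (sym e , ∼-sym d)

diff1⇒∼ : ∀ m n → T (diff1 m n) → m ∼ n
diff1⇒∼ m n t with to T-∨ t
... | inj₁ e = inj₁ (ℕ.≡ᵇ⇒≡ _ _ e)
... | inj₂ e = inj₂ (ℕ.≡ᵇ⇒≡ _ _ e)

∼⇒diff1 : ∀ m n → m ∼ n → T (diff1 m n)
∼⇒diff1 m n (inj₁ e) = from T-∨ (inj₁ (ℕ.≡⇒≡ᵇ _ _ e))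
∼⇒diff1 m n (inj₂ e) = from T-∨ (inj₂ (ℕ.≡⇒≡ᵇ _ _ e))

Corner : {a₁ a₂ : ℕ} → V a₁ a₂ → Set
Corner {a₁} {a₂} (i , j) = (toℕ i ≡ 0 ⊎ toℕ i ≡ a₁ ∸ 1) × (toℕ j ≡ 0 ⊎ toℕ j ≡ a₂ ∸ 1)

module Grid (a₁ a₂ : ℕ) where

  Vs : List (V a₁ a₂)
  Vs = vertices a₁ a₂

  X Y : V a₁ a₂ → ℕ
  X = toℕ ∘ proj₁
  Y = toℕ ∘ proj₂

  pos : V a₁ a₂ → ℕ × ℕ
  pos v = X v , Y v

  InGrid : ℕ × ℕ → Set
  InGrid (x , y) = x < a₁ × y < a₂

  inGrid : ∀ v → InGrid (pos v)
  inGrid (i , j) = toℕ<n i , toℕ<n j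

  at : ∀ p → InGrid p → V a₁ a₂
  at (x , y) (x< , y<) = fromℕ< x< , fromℕ< y<

  pos-at : ∀ p r → pos (at p r) ≡ p
  pos-at (x , y) (x< , y<) = cong₂ _,_ (toℕ-fromℕ< x<) (toℕ-fromℕ< y<)

  at-pos : ∀ v → at (pos v) (inGrid v) ≡ v
  at-pos (i , j) = cong₂ _,_ (fromℕ<-toℕ i _) (fromℕ<-toℕ j _)

  pos-injective : ∀ {u w} → pos u ≡ pos w → u ≡ w
  pos-injective e = cong₂ _,_ (toℕ-injective (cong proj₁ e)) (toℕ-injective (cong proj₂ e))

  Adj⇒GridAdj : ∀ u w → Adj u w → GridAdj (pos u) (pos w)
  Adj⇒GridAdj u w a with to T-∨ (≡true⇒T a)
  ... | inj₁ t = let e , d = to T-∧ t in inj₁ (ℕ.≡ᵇ⇒≡ _ _ e , diff1⇒∼ _ _ d)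
  ... | inj₂ t = let e , d = to T-∧ t in inj₂ (ℕ.≡ᵇ⇒≡ _ _ e , diff1⇒∼ _ _ d)

  GridAdj⇒Adj : ∀ u w → GridAdj (pos u) (pos w) → Adj u w
  GridAdj⇒Adj u w (inj₁ (e , d)) =
    T⇒≡true (from T-∨ (inj₁ (from T-∧ (ℕ.≡⇒≡ᵇ _ _ e , ∼⇒diff1 _ _ d))))
  GridAdj⇒Adj u w (inj₂ (e , d)) =
    T⇒≡true (from T-∨ (inj₂ (from T-∧ (ℕ.≡⇒≡ᵇ _ _ e , ∼⇒diff1 _ _ d))))

  Adj-sym : ∀ u w → Adj u w → Adj w u
  Adj-sym u w a = GridAdj⇒Adj w u (GridAdj-sym (Adj⇒GridAdj u w a))

  adj-comm : ∀ v w → adj v w ≡ adj w v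
  adj-comm v w with adj v w in e₁ | adj w v in e₂
  ... | true  | true  = refl
  ... | false | false = refl
  ... | true  | false = trans (sym (Adj-sym v w e₁)) e₂
  ... | false | true  = trans (sym e₁) (Adj-sym w v e₂)

  Adj-at : ∀ p q r s → GridAdj p q → Adj (at p r) (at q s)
  Adj-at p q r s a = GridAdj⇒Adj _ _ (subst₂ GridAdj (sym (pos-at p r)) (sym (pos-at q s)) a)

  inGrid? : ∀ p → Dec (InGrid p)
  inGrid? (x , y) = (x ℕ.<? a₁) ×-dec (y ℕ.<? a₂)

  OnBoundary : ℕ × ℕ → Set
  OnBoundary (x , y) = x ≡ 0 ⊎ x ≡ a₁ ∸ 1 ⊎ y ≡ 0 ⊎ y ≡ a₂ ∸ 1

  ∈-vertices : ∀ v → v ∈ Vs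
  ∈-vertices (i , j) = ∈-cartesianProduct⁺ (∈-allFin i) (∈-allFin j)

  vertices-unique : Unique Vs
  vertices-unique = Unique.cartesianProduct⁺ (Unique.allFin⁺ a₁) (Unique.allFin⁺ a₂)

  OnCorner : ℕ × ℕ → Set
  OnCorner (x , y) = (x ≡ 0 ⊎ x ≡ a₁ ∸ 1) × (y ≡ 0 ⊎ y ≡ a₂ ∸ 1)

  onBoundary? : ∀ p → Dec (OnBoundary p)
  onBoundary? (x , y) = (x ℕ.≟ 0) ⊎-dec (x ℕ.≟ a₁ ∸ 1) ⊎-dec (y ℕ.≟ 0) ⊎-dec (y ℕ.≟ a₂ ∸ 1)

  ∑-vertices-X : ∀ (f : ℕ → ℕ) → ∑ Vs (f ∘ X) ≡ a₂ * ∑< a₁ f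
  ∑-vertices-X f = begin
    ∑ Vs (f ∘ X)
      ≡⟨ ∑-cartesianProduct (allFin a₁) (allFin a₂) (f ∘ X) ⟩
    ∑ (allFin a₁) (λ i → ∑ (allFin a₂) (λ _ → f (toℕ i)))
      ≡⟨ ∑-cong (allFin a₁) (∑-const (allFin a₂) ∘ f ∘ toℕ) ⟩
    ∑ (allFin a₁) (λ i → length (allFin a₂) * f (toℕ i))
      ≡⟨ ∑-*ˡ (allFin a₁) (length (allFin a₂)) (f ∘ toℕ) ⟩
    length (allFin a₂) * ∑ (allFin a₁) (f ∘ toℕ)
      ≡⟨ cong₂ _*_ (length-tabulate {n = a₂} id) (∑-allFin a₁ f) ⟩
    a₂ * ∑< a₁ f
      ∎
    where open ≡-Reasoning

  ∑-vertices-Y : ∀ (f : ℕ → ℕ) → ∑ Vs (f ∘ Y) ≡ a₁ * ∑< a₂ f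
  ∑-vertices-Y f = begin
    ∑ Vs (f ∘ Y)
      ≡⟨ ∑-cartesianProduct (allFin a₁) (allFin a₂) (f ∘ Y) ⟩
    ∑ (allFin a₁) (λ _ → ∑ (allFin a₂) (f ∘ toℕ))
      ≡⟨ ∑-const (allFin a₁) _ ⟩
    length (allFin a₁) * ∑ (allFin a₂) (f ∘ toℕ)
      ≡⟨ cong₂ _*_ (length-tabulate {n = a₁} id) (∑-allFin a₂ f) ⟩
    a₁ * ∑< a₂ f
      ∎
    where open ≡-Reasoning

  gridDegree : V a₁ a₂ → ℕ
  gridDegree v = lineDegree a₁ (X v) + lineDegree a₂ (Y v)

  ∑-gridDegree : ∑ Vs gridDegree ≡ a₂ * ((a₁ ∸ 1) + (a₁ ∸ 1)) + a₁ * ((a₂ ∸ 1) + (a₂ ∸ 1))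
  ∑-gridDegree = trans (∑-+ Vs _ _)
    (cong₂ _+_ (trans (∑-vertices-X (lineDegree a₁)) (cong (a₂ *_) (∑<-lineDegree a₁)))
               (trans (∑-vertices-Y (lineDegree a₂)) (cong (a₁ *_) (∑<-lineDegree a₂))))

  ∑-located : ∀ (P : V a₁ a₂ → Bool) p → (∀ w → P w ≡ true → pos w ≡ p) → ∑ Vs (bit ∘ P) ≤ 1
  ∑-located P p located = ∑-≤1 Vs (bit ∘ P) vertices-unique (bit≤1 ∘ P) λ w w′ Pw Pw′ →
    pos-injective (trans (located w (bit-pos Pw)) (sym (located w′ (bit-pos Pw′))))

  ∑-never : ∀ (P : V a₁ a₂ → Bool) → (∀ w → P w ≢ true) → ∑ Vs (bit ∘ P) ≤ 0
  ∑-never P never = ℕ.≤-reflexive (∑-zero Vs (bit ∘ P) λ w _ → cong bit (BoolP.¬-not (never w)))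

  degree : V a₁ a₂ → ℕ
  degree v = ∑ Vs (λ w → bit (adj v w))

  private
    ≡ᵇ-∧⁻ : ∀ a b c d → ((a ≡ᵇ b) ∧ (c ≡ᵇ d)) ≡ true → a ≡ b × c ≡ d
    ≡ᵇ-∧⁻ a b c d e = let t , u = to T-∧ (≡true⇒T e) in ℕ.≡ᵇ⇒≡ a b t , ℕ.≡ᵇ⇒≡ c d u

    left-count : ∀ v → ∑ Vs (λ w → bit ((Y v ≡ᵇ Y w) ∧ (suc (X w) ≡ᵇ X v))) ≤ bit (0 <ᵇ X v)
    left-count (Fin.zero , j) = ∑-never _ λ w e → ℕ.1+n≢0 (proj₂ (≡ᵇ-∧⁻ (toℕ j) (Y w) (suc (X w)) 0 e))
    left-count (Fin.suc i , j) = ∑-located _ (toℕ i , toℕ j) λ w e →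
      let ey , ex = ≡ᵇ-∧⁻ (toℕ j) (Y w) (suc (X w)) (suc (toℕ i)) e in cong₂ _,_ (ℕ.suc-injective ex) (sym ey)

    right-count : ∀ v → ∑ Vs (λ w → bit ((Y v ≡ᵇ Y w) ∧ (suc (X v) ≡ᵇ X w))) ≤ bit (suc (X v) <ᵇ a₁)
    right-count v with ℕ.<-≤-connex (suc (X v)) a₁
    ... | inj₁ x+1< rewrite T⇒≡true (ℕ.<⇒<ᵇ x+1<) = ∑-located _ (suc (X v) , Y v) λ w e →
      let ey , ex = ≡ᵇ-∧⁻ (Y v) (Y w) (suc (X v)) (X w) e in cong₂ _,_ (sym ex) (sym ey)
    ... | inj₂ a₁≤ rewrite <ᵇ-false a₁≤ = ∑-never _ λ w e →
      ℕ.≤⇒≯ a₁≤ (subst (_< a₁) (sym (proj₂ (≡ᵇ-∧⁻ (Y v) (Y w) (suc (X v)) (X w) e))) (toℕ<n (proj₁ w)))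

    down-count : ∀ v → ∑ Vs (λ w → bit ((X v ≡ᵇ X w) ∧ (suc (Y w) ≡ᵇ Y v))) ≤ bit (0 <ᵇ Y v)
    down-count (i , Fin.zero) = ∑-never _ λ w e → ℕ.1+n≢0 (proj₂ (≡ᵇ-∧⁻ (toℕ i) (X w) (suc (Y w)) 0 e))
    down-count (i , Fin.suc j) = ∑-located _ (toℕ i , toℕ j) λ w e →
      let ex , ey = ≡ᵇ-∧⁻ (toℕ i) (X w) (suc (Y w)) (suc (toℕ j)) e in cong₂ _,_ (sym ex) (ℕ.suc-injective ey)

    up-count : ∀ v → ∑ Vs (λ w → bit ((X v ≡ᵇ X w) ∧ (suc (Y v) ≡ᵇ Y w))) ≤ bit (suc (Y v) <ᵇ a₂)
    up-count v with ℕ.<-≤-connex (suc (Y v)) a₂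
    ... | inj₁ y+1< rewrite T⇒≡true (ℕ.<⇒<ᵇ y+1<) = ∑-located _ (X v , suc (Y v)) λ w e →
      let ex , ey = ≡ᵇ-∧⁻ (X v) (X w) (suc (Y v)) (Y w) e in cong₂ _,_ (sym ex) (sym ey)
    ... | inj₂ a₂≤ rewrite <ᵇ-false a₂≤ = ∑-never _ λ w e →
      ℕ.≤⇒≯ a₂≤ (subst (_< a₂) (sym (proj₂ (≡ᵇ-∧⁻ (X v) (X w) (suc (Y v)) (Y w) e))) (toℕ<n (proj₂ w)))

  degree≤gridDegree : ∀ v → degree v ≤ gridDegree v
  degree≤gridDegree v = begin
    degree v                                        ≤⟨ ∑-mono-≤ Vs adj-split ⟩
    ∑ Vs (λ w → (L w + R w) + (D w + U w)) ≡⟨ ∑-+ Vs _ _ ⟩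
    ∑ Vs (λ w → L w + R w) + ∑ Vs (λ w → D w + U w)
      ≡⟨ cong₂ _+_ (∑-+ Vs L R) (∑-+ Vs D U) ⟩
    (∑ Vs L + ∑ Vs R) + (∑ Vs D + ∑ Vs U)
      ≤⟨ ℕ.+-mono-≤ (ℕ.+-mono-≤ (left-count v) (right-count v)) (ℕ.+-mono-≤ (down-count v) (up-count v)) ⟩
    gridDegree v                                    ∎
    where
    open ℕ.≤-Reasoning
    L R D U : V a₁ a₂ → ℕ
    L w = bit ((Y v ≡ᵇ Y w) ∧ (suc (X w) ≡ᵇ X v))
    R w = bit ((Y v ≡ᵇ Y w) ∧ (suc (X v) ≡ᵇ X w))
    D w = bit ((X v ≡ᵇ X w) ∧ (suc (Y w) ≡ᵇ Y v))
    U w = bit ((X v ≡ᵇ X w) ∧ (suc (Y v) ≡ᵇ Y w))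
    bit-∧-∨ : ∀ c a b → bit (c ∧ (a ∨ b)) ≤ bit (c ∧ a) + bit (c ∧ b)
    bit-∧-∨ true  a b = bit-∨ a b
    bit-∧-∨ false a b = z≤n
    adj-split : ∀ w → bit (adj v w) ≤ (L w + R w) + (D w + U w)
    adj-split w = begin
      bit (adj v w)               ≤⟨ bit-∨ ((X v ≡ᵇ X w) ∧ diff1 (Y v) (Y w)) ((Y v ≡ᵇ Y w) ∧ diff1 (X v) (X w)) ⟩
      bit ((X v ≡ᵇ X w) ∧ diff1 (Y v) (Y w)) + bit ((Y v ≡ᵇ Y w) ∧ diff1 (X v) (X w))
        ≤⟨ ℕ.+-mono-≤ (bit-∧-∨ (X v ≡ᵇ X w) (suc (Y v) ≡ᵇ Y w) (suc (Y w) ≡ᵇ Y v))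
                      (bit-∧-∨ (Y v ≡ᵇ Y w) (suc (X v) ≡ᵇ X w) (suc (X w) ≡ᵇ X v)) ⟩
      (U w + D w) + (R w + L w)   ≡⟨ ℕ.+-comm (U w + D w) _ ⟩
      (R w + L w) + (U w + D w)   ≡⟨ cong₂ _+_ (ℕ.+-comm (R w) (L w)) (ℕ.+-comm (U w) (D w)) ⟩
      (L w + R w) + (D w + U w)   ∎

  gridDegree≤4 : ∀ v → gridDegree v ≤ 4
  gridDegree≤4 v = ℕ.+-mono-≤ (lineDegree≤2 a₁ (X v)) (lineDegree≤2 a₂ (Y v))

  gridDegree-boundary : ∀ v → Boundary v → gridDegree v ≤ 3
  gridDegree-boundary v (inj₁ e) =
    ℕ.+-mono-≤ (lineDegree-end a₁ (X v) (inj₁ e) (toℕ<n (proj₁ v))) (lineDegree≤2 a₂ (Y v))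
  gridDegree-boundary v (inj₂ (inj₁ e)) =
    ℕ.+-mono-≤ (lineDegree-end a₁ (X v) (inj₂ e) (toℕ<n (proj₁ v))) (lineDegree≤2 a₂ (Y v))
  gridDegree-boundary v (inj₂ (inj₂ (inj₁ e))) =
    ℕ.+-mono-≤ {y = 2} (lineDegree≤2 a₁ (X v)) (lineDegree-end a₂ (Y v) (inj₁ e) (toℕ<n (proj₂ v)))
  gridDegree-boundary v (inj₂ (inj₂ (inj₂ e))) =
    ℕ.+-mono-≤ {y = 2} (lineDegree≤2 a₁ (X v)) (lineDegree-end a₂ (Y v) (inj₂ e) (toℕ<n (proj₂ v)))

  gridDegree-corner : ∀ v → Corner v → gridDegree v ≤ 2
  gridDegree-corner v (cx , cy) =
    ℕ.+-mono-≤ (lineDegree-end a₁ (X v) cx (toℕ<n (proj₁ v))) (lineDegree-end a₂ (Y v) cy (toℕ<n (proj₂ v)))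

  gridDegree-interior : ∀ v → ¬ Boundary v → 4 ≤ gridDegree v
  gridDegree-interior v ¬bd = ℕ.+-mono-≤
    (lineDegree-inner a₁ (X v) (¬bd ∘ inj₁) (¬bd ∘ inj₂ ∘ inj₁) (toℕ<n (proj₁ v)))
    (lineDegree-inner a₂ (Y v) (¬bd ∘ inj₂ ∘ inj₂ ∘ inj₁) (¬bd ∘ inj₂ ∘ inj₂ ∘ inj₂) (toℕ<n (proj₂ v)))

_∉ˢ_ : {a₁ a₂ : ℕ} → V a₁ a₂ → VSet a₁ a₂ → Set
v ∉ˢ A = A v ≡ false

LaterNeighbour : {a₁ a₂ : ℕ} → (V a₁ a₂ → ℕ) → V a₁ a₂ → V a₁ a₂ → Set
LaterNeighbour time v w = Adj v w × time v < time w

-- The local structure of the infection times of a percolating set of the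
-- extremal size: a vertex outside A₀ has exactly (its degree) − 3
-- neighbours infected after it.
record ExtremalSchedule {a₁ a₂ : ℕ} (A₀ : VSet a₁ a₂) : Set where
  field
    time            : V a₁ a₂ → ℕ
    time≡0⇒∈        : ∀ {v} → time v ≡ 0 → v ∈ˢ A₀
    ∈⇒time≡0        : ∀ {v} → v ∈ˢ A₀ → time v ≡ 0
    Adj⇒time≢       : ∀ {u w} → Adj u w → time u ≢ time w
    later-unique    : ∀ {v w₁ w₂} → v ∉ˢ A₀ →
                      LaterNeighbour time v w₁ → LaterNeighbour time v w₂ → w₁ ≡ w₂
    interior-later  : ∀ {v} → v ∉ˢ A₀ → ¬ Boundary v → ∃ (LaterNeighbour time v)
    boundary-latest : ∀ {v w} → v ∉ˢ A₀ → Boundary v → ¬ LaterNeighbour time v w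
    corner∈         : ∀ {v} → Corner v → v ∈ˢ A₀

module Consequences {a₁ a₂ : ℕ} {A₀ : VSet a₁ a₂} (S : ExtremalSchedule A₀) where
  open ExtremalSchedule S
  open Grid a₁ a₂

  infix 4 _≺_
  _≺_ : V a₁ a₂ → V a₁ a₂ → Set
  u ≺ w = time u < time w

  ≺⇒∉ : ∀ {u w} → u ≺ w → w ∉ˢ A₀
  ≺⇒∉ {u} {w} u≺w with A₀ w in e
  ... | true  = ⊥-elim (ℕ.n≮0 (subst (time u <_) (∈⇒time≡0 e) u≺w))
  ... | false = refl

  ∉⇒0<time : ∀ {v} → v ∉ˢ A₀ → 0 < time v
  ∉⇒0<time {v} v∉ with time v in e
  ... | zero  = ⊥-elim (false≢true (trans (sym v∉) (time≡0⇒∈ e)))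
  ... | suc _ = s≤s z≤n

  Adj⇒≺⊎≻ : ∀ {u w} → Adj u w → u ≺ w ⊎ w ≺ u
  Adj⇒≺⊎≻ {u} {w} a with ℕ.<-cmp (time u) (time w)
  ... | tri< lt _ _ = inj₁ lt
  ... | tri≈ _ e _  = ⊥-elim (Adj⇒time≢ a e)
  ... | tri> _ _ gt = inj₂ gt

  one-of-two-earlier : ∀ {v w₁ w₂} → v ∉ˢ A₀ → Adj v w₁ → Adj v w₂ → w₁ ≢ w₂ →
                       w₁ ≺ v ⊎ w₂ ≺ v
  one-of-two-earlier v∉ v~w₁ v~w₂ w₁≢w₂ with Adj⇒≺⊎≻ v~w₁ | Adj⇒≺⊎≻ v~w₂
  ... | inj₂ w₁≺v | _         = inj₁ w₁≺v
  ... | inj₁ _    | inj₂ w₂≺v = inj₂ w₂≺v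
  ... | inj₁ v≺w₁ | inj₁ v≺w₂ = ⊥-elim (w₁≢w₂ (later-unique v∉ (v~w₁ , v≺w₁) (v~w₂ , v≺w₂)))

  independent : Independent A₀
  independent u w u∈ w∈ a = Adj⇒time≢ a (trans (∈⇒time≡0 u∈) (sym (∈⇒time≡0 w∈)))

  Linked-last : ∀ {R : V a₁ a₂ → V a₁ a₂ → Set} l {p c} → Linked R (l ++ p ∷ c ∷ []) → R p c
  Linked-last []      w = Linked.head w
  Linked-last (_ ∷ l) w = Linked-last l (Linked.tail w)

  Linked⇒head-All : ∀ {R : V a₁ a₂ → V a₁ a₂ → Set} → (∀ {u v w} → R u v → R v w → R u w) →
                    ∀ {x xs} → Linked R (x ∷ xs) → All (R x) xs
  Linked⇒head-All trans {xs = xs} w with Linked⇒AllPairs trans w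
  ... | r ∷ _ = r

  -- Along a path outside A₀, once the infection time decreases it keeps
  -- decreasing: a local minimum would have two later neighbours.
  descend : ∀ {a b r} → Linked Adj (a ∷ b ∷ r) → Unique (a ∷ b ∷ r) → All (_∉ˢ A₀) (b ∷ r) →
            b ≺ a → Linked (flip _≺_) (a ∷ b ∷ r)
  descend {r = []} _ _ _ b≺a = b≺a ∷ [-]
  descend {a} {b} {c ∷ r} (a~b ∷ b~c ∷ w) ((_ ∷ a≢c ∷ _) ∷ u) (b∉ ∷ h) b≺a =
    b≺a ∷ descend (b~c ∷ w) u h c≺b
    where
    c≺b : c ≺ b
    c≺b with Adj⇒≺⊎≻ b~c
    ... | inj₂ c≺b = c≺b
    ... | inj₁ b≺c = ⊥-elim (a≢c (later-unique b∉ (Adj-sym a b a~b , b≺a) (b~c , b≺c)))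

  prepend-ascending : ∀ {a xs} → Linked Adj (a ∷ xs) → Unique (a ∷ xs) → All (_∉ˢ A₀) xs →
                      ¬ Linked (flip _≺_) (a ∷ xs) → Linked _≺_ xs → Linked _≺_ (a ∷ xs)
  prepend-ascending {xs = []}    _ _ _ _      _   = [-]
  prepend-ascending {xs = b ∷ r} w u h ¬desc asc with Adj⇒≺⊎≻ (Linked.head w)
  ... | inj₁ a≺b = a≺b ∷ asc
  ... | inj₂ b≺a = ⊥-elim (¬desc (descend w u h b≺a))

  ascend : ∀ l {p c} → Linked Adj (l ++ p ∷ c ∷ []) → Unique (l ++ p ∷ c ∷ []) →
           All (_∉ˢ A₀) (l ++ p ∷ c ∷ []) → p ≺ c → Linked _≺_ (l ++ p ∷ c ∷ [])
  ascend []      _ _ _ p≺c = p≺c ∷ [-]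
  ascend (a ∷ l) w u@(_ ∷ u′) (_ ∷ h) p≺c =
    prepend-ascending w u h (λ desc → ℕ.<-asym p≺c (Linked-last (a ∷ l) desc))
      (ascend l (Linked.tail w) u′ h p≺c)

  closed-walk-end : ∀ x y xs → 2 ≤ length xs → Walk (y ∷ xs ++ [ x ]) →
                    Linked Adj (y ∷ xs) × Σ (List (V a₁ a₂)) λ zs → ∃₂ λ p c → xs ≡ zs ++ p ∷ c ∷ [] × Adj c x
  closed-walk-end x y (p ∷ c ∷ []) _ (y~p , p~c , c~x , _) =
    y~p ∷ p~c ∷ [-] , [] , p , c , refl , c~x
  closed-walk-end x y (_ ∷ []) (s≤s ()) _
  closed-walk-end x y (a ∷ b ∷ c ∷ r) _ (y~a , w) with closed-walk-end x a (b ∷ c ∷ r) (s≤s (s≤s z≤n)) w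
  ... | path , zs , p , d , eq , d~x = y~a ∷ path , a ∷ zs , p , d , cong (a ∷_) eq , d~x

  ∈-last : ∀ zs {b p c : V a₁ a₂} {r} → b ∷ r ≡ zs ++ p ∷ c ∷ [] → c ∈ r
  ∈-last []       refl = here refl
  ∈-last (_ ∷ zs) refl = ∈-++⁺ʳ zs (there (here refl))

  -- On a cycle outside A₀, compare the first vertex x with its predecessor c:
  -- whichever of the two is earlier starts a monotone path that runs into
  -- the other one from the wrong side.
  no-cycle : ∀ x xs → IsCycle x xs → ¬ All (_∉ˢ A₀) (x ∷ xs)
  no-cycle x [] (() , _)
  no-cycle x (b ∷ r) (2≤ , u@(x≢ ∷ b≢ ∷ _) , w) h@(x∉ ∷ h′)
    with closed-walk-end x x (b ∷ r) 2≤ w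
  ... | path , zs , p , c , eq , c~x = [ c≺x⇒⊥ , x≺c⇒⊥ ]′ (Adj⇒≺⊎≻ c~x)
    where
    c∈r : c ∈ r
    c∈r = ∈-last zs eq

    x≺c⇒⊥ : x ≺ c → ⊥
    x≺c⇒⊥ x≺c = ℕ.<-asym x≺c (All.lookup (Linked⇒head-All (flip ℕ.<-trans) desc) (there c∈r))
      where
      b≺x : b ≺ x
      b≺x with Adj⇒≺⊎≻ (Linked.head path)
      ... | inj₂ b≺x = b≺x
      ... | inj₁ x≺b = ⊥-elim (All.lookup b≢ c∈r
                         (later-unique x∉ (Linked.head path , x≺b) (Adj-sym c x c~x , x≺c)))
      desc : Linked (flip _≺_) (x ∷ b ∷ r)
      desc = descend path u h′ b≺x

    P≡ : x ∷ b ∷ r ≡ (x ∷ zs) ++ p ∷ c ∷ []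
    P≡ = cong (x ∷_) eq

    c≺x⇒⊥ : c ≺ x → ⊥
    c≺x⇒⊥ c≺x = ℕ.<-asym c≺x (All.lookup (Linked⇒head-All ℕ.<-trans asc) (∈-++⁺ʳ zs (there (here refl))))
      where
      path′ : Linked Adj ((x ∷ zs) ++ p ∷ c ∷ [])
      path′ = subst (Linked Adj) P≡ path
      p~c : Adj p c
      p~c = Linked-last (x ∷ zs) path′
      p≺c : p ≺ c
      p≺c with Adj⇒≺⊎≻ p~c
      ... | inj₁ p≺c = p≺c
      ... | inj₂ c≺p = ⊥-elim (All.lookup x≢ (subst (p ∈_) (sym eq) (∈-++⁺ʳ zs (here refl)))
                         (sym (later-unique (All.lookup h′ (there c∈r)) (Adj-sym p c p~c , c≺p) (c~x , c≺x))))
      asc : Linked _≺_ ((x ∷ zs) ++ p ∷ c ∷ [])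
      asc = ascend (x ∷ zs) path′ (subst Unique P≡ u) (subst (All (_∉ˢ A₀)) P≡ h) p≺c

  ∈compl⇒∉ : ∀ {v} → v ∈ˢ compl A₀ → v ∉ˢ A₀
  ∈compl⇒∉ {v} e with A₀ v
  ... | false = refl

  ∉⇒∈compl : ∀ {v} → v ∉ˢ A₀ → v ∈ˢ compl A₀
  ∉⇒∈compl e = cong not e

  reach⇒∉ : ∀ {u w} → Reach (compl A₀) u w → w ∉ˢ A₀
  reach⇒∉ (here u∈)      = ∈compl⇒∉ u∈
  reach⇒∉ (there _ w∈ _) = ∈compl⇒∉ w∈

  component-is-tree : ∀ u → CompIsTree (compl A₀) u
  component-is-tree u x xs cycle in-component = no-cycle x xs cycle (All.map reach⇒∉ in-component)

  later? : ∀ v → Dec (∃ (LaterNeighbour time v))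
  later? v with any? (λ w → (adj v w BoolP.≟ true) ×-dec (time v ℕ.<? time w)) Vs
  ... | yes found = yes (Any.satisfied found)
  ... | no ¬found = no λ (w , later) → ¬found (Any.map (λ { refl → later }) (∈-vertices w))

  climb : ℕ → V a₁ a₂ → V a₁ a₂
  climb zero    v = v
  climb (suc n) v with later? v
  ... | yes (w , _) = climb n w
  ... | no _        = v

  time-bound : ℕ
  time-bound = ∑ Vs time

  no-fuel : ∀ v → ¬ time-bound < time v + 0
  no-fuel v lt = ℕ.<-irrefl refl (ℕ.<-≤-trans lt (subst (_≤ time-bound) (sym (ℕ.+-identityʳ (time v)))
                                                   (∈⇒≤∑ time (∈-vertices v))))

  fuel-step : ∀ {v w} n → time-bound < time v + suc n → v ≺ w → time-bound < time w + n
  fuel-step {v} {w} n lt v≺w =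
    ℕ.<-≤-trans lt (subst (_≤ time w + n) (sym (ℕ.+-suc (time v) n)) (ℕ.+-monoˡ-≤ n v≺w))

  climb-reach : ∀ {u} n v → Reach (compl A₀) u v → Reach (compl A₀) u (climb n v)
  climb-reach zero    v r = r
  climb-reach (suc n) v r with later? v
  ... | yes (w , v~w , v≺w) = climb-reach n w (there r (∉⇒∈compl (≺⇒∉ v≺w)) v~w)
  ... | no _                = r

  climb-top : ∀ n v → time-bound < time v + n → ¬ ∃ (LaterNeighbour time (climb n v))
  climb-top zero    v lt = ⊥-elim (no-fuel v lt)
  climb-top (suc n) v lt with later? v
  ... | yes (w , _ , v≺w) = climb-top n w (fuel-step n lt v≺w)
  ... | no none           = none

  climb-stable : ∀ n v → time-bound < time v + n → climb (suc n) v ≡ climb n v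
  climb-stable zero    v lt = ⊥-elim (no-fuel v lt)
  climb-stable (suc n) v lt with later? v
  ... | yes (w , _ , v≺w) = climb-stable n w (fuel-step n lt v≺w)
  ... | no _              = refl

  root : V a₁ a₂ → V a₁ a₂
  root = climb (suc time-bound)

  enough-fuel : ∀ v → time-bound < time v + suc time-bound
  enough-fuel v = ℕ.m≤n+m (suc time-bound) (time v)

  root-later : ∀ {v w} → v ∉ˢ A₀ → LaterNeighbour time v w → root v ≡ root w
  root-later {v} {w} v∉ later with later? v
  ... | yes (w′ , later′) rewrite later-unique v∉ later′ later =
    sym (climb-stable time-bound w (ℕ.+-monoˡ-≤ time-bound (∉⇒0<time (≺⇒∉ (proj₂ later)))))
  ... | no none = ⊥-elim (none (w , later))

  reach⇒root≡ : ∀ {u w} → Reach (compl A₀) u w → root u ≡ root w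
  reach⇒root≡ (here _) = refl
  reach⇒root≡ (there {w = w} {x} r x∈ w~x) with Adj⇒≺⊎≻ w~x
  ... | inj₁ w≺x = trans (reach⇒root≡ r) (root-later (reach⇒∉ r) (w~x , w≺x))
  ... | inj₂ x≺w = trans (reach⇒root≡ r) (sym (root-later (∈compl⇒∉ x∈) (Adj-sym w x w~x , x≺w)))

  boundary-root : ∀ {v} → v ∉ˢ A₀ → Boundary v → root v ≡ v
  boundary-root {v} v∉ bd with later? v
  ... | yes (_ , later) = ⊥-elim (boundary-latest v∉ bd later)
  ... | no _            = refl

  root-boundary : ∀ {u} → u ∈ˢ compl A₀ → Boundary (root u)
  root-boundary {u} u∈ with onBoundary? (pos (root u))
  ... | yes bd = bd
  ... | no ¬bd = ⊥-elim (climb-top (suc time-bound) u (enough-fuel u)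
                   (interior-later (reach⇒∉ (climb-reach (suc time-bound) u (here u∈))) ¬bd))

  one-boundary-vertex : ∀ u → u ∈ˢ compl A₀ → CompOneBoundary (compl A₀) u
  one-boundary-vertex u u∈ =
    root u , climb-reach (suc time-bound) u (here u∈) , root-boundary u∈ ,
    λ b r bd → trans (sym (boundary-root (reach⇒∉ r) bd)) (sym (reach⇒root≡ r))

  A₀ᴺ : ℕ × ℕ → Bool
  A₀ᴺ p with inGrid? p
  ... | yes r = A₀ (at p r)
  ... | no _  = false

  A₀ᴺ-at : ∀ p r → A₀ᴺ p ≡ A₀ (at p r)
  A₀ᴺ-at p r with inGrid? p
  ... | yes _ = refl
  ... | no ¬r = ⊥-elim (¬r r)

  A₀ᴺ-pos : ∀ v → A₀ᴺ (pos v) ≡ A₀ v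
  A₀ᴺ-pos v = trans (A₀ᴺ-at (pos v) (inGrid v)) (cong A₀ (at-pos v))

  A₀ᴺ⇒InGrid : ∀ p → A₀ᴺ p ≡ true → InGrid p
  A₀ᴺ⇒InGrid p e with inGrid? p
  ... | yes r = r

  A₀ᴺ-independent : ∀ p q → A₀ᴺ p ≡ true → A₀ᴺ q ≡ true → ¬ GridAdj p q
  A₀ᴺ-independent p q p∈ q∈ a =
    independent (at p r) (at q s) (trans (sym (A₀ᴺ-at p r)) p∈) (trans (sym (A₀ᴺ-at q s)) q∈) (Adj-at p q r s a)
    where
    r : InGrid p
    r = A₀ᴺ⇒InGrid p p∈
    s : InGrid q
    s = A₀ᴺ⇒InGrid q q∈

  -- The earlier of two adjacent boundary vertices outside A₀ would have a
  -- later neighbour.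
  boundary-edge-meets-A₀ : ∀ p q → InGrid p → InGrid q → GridAdj p q → OnBoundary p → OnBoundary q →
                           A₀ᴺ p ≡ false → A₀ᴺ q ≡ false → ⊥
  boundary-edge-meets-A₀ p q r s a bp bq p∉ q∉ with Adj⇒≺⊎≻ (Adj-at p q r s a)
  ... | inj₁ u≺w = boundary-latest (trans (sym (A₀ᴺ-at p r)) p∉) (subst OnBoundary (sym (pos-at p r)) bp)
                     (Adj-at p q r s a , u≺w)
  ... | inj₂ w≺u = boundary-latest (trans (sym (A₀ᴺ-at q s)) q∉) (subst OnBoundary (sym (pos-at q s)) bq)
                     (Adj-at q p s r (GridAdj-sym a) , w≺u)

  alternating-side : ∀ (line : ℕ → ℕ × ℕ) n → (∀ i → i < n → InGrid (line i)) →
                     (∀ i → suc i < n → GridAdj (line i) (line (suc i))) → (∀ i → i < n → OnBoundary (line i)) →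
                     A₀ᴺ (line 0) ≡ true → ∀ i → i < n → A₀ᴺ (line i) ≡ isEven i
  alternating-side line n in-grid adjacent on-boundary first∈ zero    _ = first∈
  alternating-side line n in-grid adjacent on-boundary first∈ (suc i) i+1<n
    with alternating-side line n in-grid adjacent on-boundary first∈ i (ℕ.<-trans (ℕ.n<1+n i) i+1<n)
  ... | ih rewrite isEven-suc i with isEven i | A₀ᴺ (line (suc i)) in e
  ... | true  | false = refl
  ... | false | true  = refl
  ... | true  | true  = ⊥-elim (A₀ᴺ-independent (line i) (line (suc i)) ih e (adjacent i i+1<n))
  ... | false | false = ⊥-elim (boundary-edge-meets-A₀ (line i) (line (suc i))
                          (in-grid i (ℕ.<-trans (ℕ.n<1+n i) i+1<n)) (in-grid (suc i) i+1<n) (adjacent i i+1<n)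
                          (on-boundary i (ℕ.<-trans (ℕ.n<1+n i) i+1<n)) (on-boundary (suc i) i+1<n) ih e)

  module Parity (0<a₁ : 0 < a₁) (0<a₂ : 0 < a₂) where

    pred<a₁ : a₁ ∸ 1 < a₁
    pred<a₁ = ℕ.∸-monoʳ-< {a₁} {1} {0} (s≤s z≤n) 0<a₁
    pred<a₂ : a₂ ∸ 1 < a₂
    pred<a₂ = ℕ.∸-monoʳ-< {a₂} {1} {0} (s≤s z≤n) 0<a₂

    corner∈ᴺ : ∀ p → InGrid p → OnCorner p → A₀ᴺ p ≡ true
    corner∈ᴺ p r c = trans (A₀ᴺ-at p r) (corner∈ (subst OnCorner (sym (pos-at p r)) c))

    bottom-side : ∀ x → x < a₁ → A₀ᴺ (x , 0) ≡ isEven x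
    bottom-side = alternating-side (_, 0) a₁ (λ _ x< → x< , 0<a₂) (λ _ _ → inj₂ (refl , inj₁ refl))
      (λ _ _ → inj₂ (inj₂ (inj₁ refl))) (corner∈ᴺ (0 , 0) (0<a₁ , 0<a₂) (inj₁ refl , inj₁ refl))

    top-side : ∀ x → x < a₁ → A₀ᴺ (x , a₂ ∸ 1) ≡ isEven x
    top-side = alternating-side (_, a₂ ∸ 1) a₁ (λ _ x< → x< , pred<a₂) (λ _ _ → inj₂ (refl , inj₁ refl))
      (λ _ _ → inj₂ (inj₂ (inj₂ refl))) (corner∈ᴺ (0 , a₂ ∸ 1) (0<a₁ , pred<a₂) (inj₁ refl , inj₂ refl))

    left-side : ∀ y → y < a₂ → A₀ᴺ (0 , y) ≡ isEven y
    left-side = alternating-side (0 ,_) a₂ (λ _ y< → 0<a₁ , y<) (λ _ _ → inj₁ (refl , inj₁ refl))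
      (λ _ _ → inj₁ refl) (corner∈ᴺ (0 , 0) (0<a₁ , 0<a₂) (inj₁ refl , inj₁ refl))

    right-side : ∀ y → y < a₂ → A₀ᴺ (a₁ ∸ 1 , y) ≡ isEven y
    right-side = alternating-side (a₁ ∸ 1 ,_) a₂ (λ _ y< → pred<a₁ , y<) (λ _ _ → inj₁ (refl , inj₁ refl))
      (λ _ _ → inj₂ (inj₁ refl)) (corner∈ᴺ (a₁ ∸ 1 , 0) (pred<a₁ , 0<a₂) (inj₂ refl , inj₁ refl))

    pred-a₁-even : isEven (a₁ ∸ 1) ≡ true
    pred-a₁-even = trans (sym (bottom-side (a₁ ∸ 1) pred<a₁))
                         (corner∈ᴺ (a₁ ∸ 1 , 0) (pred<a₁ , 0<a₂) (inj₂ refl , inj₁ refl))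

    pred-a₂-even : isEven (a₂ ∸ 1) ≡ true
    pred-a₂-even = trans (sym (left-side (a₂ ∸ 1) pred<a₂))
                         (corner∈ᴺ (0 , a₂ ∸ 1) (0<a₁ , pred<a₂) (inj₁ refl , inj₂ refl))

    sides-odd : OddNat a₁ × OddNat a₂
    sides-odd = odd-if-pred-even a₁ 0<a₁ pred-a₁-even , odd-if-pred-even a₂ 0<a₂ pred-a₂-even

    boundary-parity : ∀ x y → InGrid (x , y) → OnBoundary (x , y) → A₀ᴺ (x , y) ≡ isEven (x + y)
    boundary-parity x y (x< , y<) (inj₁ refl) = left-side y y<
    boundary-parity x y (x< , y<) (inj₂ (inj₁ refl)) =
      trans (right-side y y<) (sym (isEven-+ (a₁ ∸ 1) y pred-a₁-even))
    boundary-parity x y (x< , y<) (inj₂ (inj₂ (inj₁ refl))) =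
      trans (bottom-side x x<) (cong isEven (sym (ℕ.+-identityʳ x)))
    boundary-parity x y (x< , y<) (inj₂ (inj₂ (inj₂ refl))) =
      trans (top-side x x<) (sym (trans (cong isEven (ℕ.+-comm x (a₂ ∸ 1))) (isEven-+ (a₂ ∸ 1) x pred-a₂-even)))

    boundary-even⇒∈ : ∀ v → Boundary v → Even v → v ∈ˢ A₀
    boundary-even⇒∈ v bd 2∣ =
      trans (sym (A₀ᴺ-pos v)) (trans (boundary-parity (X v) (Y v) (inGrid v) bd) (2∣⇒isEven _ 2∣))

    ∈ᴺ-boundary-even : ∀ x y → A₀ᴺ (x , y) ≡ true → OnBoundary (x , y) → false ≡ not (isEven (x + y))
    ∈ᴺ-boundary-even x y p∈ bd = cong not (trans (sym p∈) (boundary-parity x y (A₀ᴺ⇒InGrid (x , y) p∈) bd))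

    right-end : ∀ x y → A₀ᴺ (x , y) ≡ true → a₁ ≤ suc x → OnBoundary (x , y)
    right-end x y p∈ a₁≤ = inj₂ (inj₁ (last-below (proj₁ (A₀ᴺ⇒InGrid (x , y) p∈)) a₁≤))

    top-end : ∀ x y → A₀ᴺ (x , y) ≡ true → a₂ ≤ suc y → OnBoundary (x , y)
    top-end x y p∈ a₂≤ = inj₂ (inj₂ (inj₂ (last-below (proj₂ (A₀ᴺ⇒InGrid (x , y) p∈)) a₂≤)))

    neighbour∉ᴺ : ∀ p q → A₀ᴺ p ≡ true → GridAdj p q → A₀ᴺ q ≡ false
    neighbour∉ᴺ p q p∈ a with A₀ᴺ q in e
    ... | true  = ⊥-elim (A₀ᴺ-independent p q p∈ e a)
    ... | false = refl

    -- oddFace i j describes the unit square with corners (i ∸ 1 , j ∸ 1) and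
    -- (i , j): it is true when the A₀-vertices of the square are odd (by
    -- independence they lie on one diagonal).  Squares outside the grid count
    -- as even.
    oddFace : ℕ → ℕ → Bool
    oddFace (suc x) (suc y) =
      if (suc x <ᵇ a₁) ∧ (suc y <ᵇ a₂) then (A₀ᴺ (x , y) ∨ A₀ᴺ (suc x , suc y)) xor isEven (x + y) else false
    oddFace _ _ = false

    oddFace-inside : ∀ x y → suc x < a₁ → suc y < a₂ →
                     oddFace (suc x) (suc y) ≡ (A₀ᴺ (x , y) ∨ A₀ᴺ (suc x , suc y)) xor isEven (x + y)
    oddFace-inside x y x< y< =
      cong (if_then (A₀ᴺ (x , y) ∨ A₀ᴺ (suc x , suc y)) xor isEven (x + y) else false)
           (cong₂ _∧_ (T⇒≡true (ℕ.<⇒<ᵇ x<)) (T⇒≡true (ℕ.<⇒<ᵇ y<)))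

    oddFace-bottom : ∀ x → oddFace x 0 ≡ false
    oddFace-bottom zero    = refl
    oddFace-bottom (suc x) = refl

    oddFace-right : ∀ x y → a₁ ≤ x → oddFace x y ≡ false
    oddFace-right zero    y       _ = refl
    oddFace-right (suc x) zero    _ = refl
    oddFace-right (suc x) (suc y) a₁≤ =
      cong (λ c → if c ∧ (suc y <ᵇ a₂) then (A₀ᴺ (x , y) ∨ A₀ᴺ (suc x , suc y)) xor isEven (x + y) else false)
           (<ᵇ-false a₁≤)

    oddFace-top : ∀ x y → a₂ ≤ y → oddFace x y ≡ false
    oddFace-top zero    y       _ = refl
    oddFace-top (suc x) zero    _ = refl
    oddFace-top (suc x) (suc y) a₂≤ =
      cong (if_then (A₀ᴺ (x , y) ∨ A₀ᴺ (suc x , suc y)) xor isEven (x + y) else false)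
           (trans (cong ((suc x <ᵇ a₁) ∧_) (<ᵇ-false a₂≤)) (BoolP.∧-zeroʳ _))

    face-below-left : ∀ x y → A₀ᴺ (x , y) ≡ true → oddFace x y ≡ not (isEven (x + y))
    face-below-left zero    y       p∈ = ∈ᴺ-boundary-even 0 y p∈ (inj₁ refl)
    face-below-left (suc x) zero    p∈ = ∈ᴺ-boundary-even (suc x) 0 p∈ (inj₂ (inj₂ (inj₁ refl)))
    face-below-left (suc x) (suc y) p∈ = begin
      oddFace (suc x) (suc y)
        ≡⟨ oddFace-inside x y (proj₁ r) (proj₂ r) ⟩
      (A₀ᴺ (x , y) ∨ A₀ᴺ (suc x , suc y)) xor isEven (x + y)
        ≡⟨ cong (λ b → (A₀ᴺ (x , y) ∨ b) xor isEven (x + y)) p∈ ⟩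
      (A₀ᴺ (x , y) ∨ true) xor isEven (x + y)
        ≡⟨ cong (_xor isEven (x + y)) (BoolP.∨-zeroʳ (A₀ᴺ (x , y))) ⟩
      not (isEven (x + y))
        ≡⟨ cong (not ∘ isEven ∘ suc) (ℕ.+-suc x y) ⟨
      not (isEven (suc x + suc y))
        ∎
      where
      open ≡-Reasoning
      r : InGrid (suc x , suc y)
      r = A₀ᴺ⇒InGrid (suc x , suc y) p∈

    face-below-right : ∀ x y → A₀ᴺ (x , y) ≡ true → oddFace (suc x) y ≡ not (isEven (x + y))
    face-below-right x zero p∈ = ∈ᴺ-boundary-even x 0 p∈ (inj₂ (inj₂ (inj₁ refl)))
    face-below-right x (suc y) p∈ with ℕ.<-≤-connex (suc x) a₁
    ... | inj₂ a₁≤ = trans (oddFace-right (suc x) (suc y) a₁≤)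
                           (∈ᴺ-boundary-even x (suc y) p∈ (right-end x (suc y) p∈ a₁≤))
    ... | inj₁ x+1< = begin
      oddFace (suc x) (suc y)
        ≡⟨ oddFace-inside x y x+1< (proj₂ (A₀ᴺ⇒InGrid (x , suc y) p∈)) ⟩
      (A₀ᴺ (x , y) ∨ A₀ᴺ (suc x , suc y)) xor isEven (x + y)
        ≡⟨ cong₂ (λ b c → (b ∨ c) xor isEven (x + y))
                 (neighbour∉ᴺ (x , suc y) (x , y) p∈ (inj₁ (refl , inj₂ refl)))
                 (neighbour∉ᴺ (x , suc y) (suc x , suc y) p∈ (inj₂ (refl , inj₁ refl))) ⟩
      isEven (x + y)
        ≡⟨ BoolP.not-involutive _ ⟨
      not (not (isEven (x + y)))
        ≡⟨ cong not (isEven-+suc x y) ⟨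
      not (isEven (x + suc y))
        ∎
      where open ≡-Reasoning

    face-above-right : ∀ x y → A₀ᴺ (x , y) ≡ true → oddFace (suc x) (suc y) ≡ not (isEven (x + y))
    face-above-right x y p∈ with ℕ.<-≤-connex (suc x) a₁ | ℕ.<-≤-connex (suc y) a₂
    ... | inj₁ x+1< | inj₁ y+1< = trans (oddFace-inside x y x+1< y+1<)
                                        (cong (λ b → (b ∨ A₀ᴺ (suc x , suc y)) xor isEven (x + y)) p∈)
    ... | inj₂ a₁≤ | _ = trans (oddFace-right (suc x) (suc y) a₁≤) (∈ᴺ-boundary-even x y p∈ (right-end x y p∈ a₁≤))
    ... | inj₁ _ | inj₂ a₂≤ = trans (oddFace-top (suc x) (suc y) a₂≤) (∈ᴺ-boundary-even x y p∈ (top-end x y p∈ a₂≤))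

    face-above-left : ∀ x y → A₀ᴺ (x , y) ≡ true → oddFace x (suc y) ≡ not (isEven (x + y))
    face-above-left zero y p∈ = ∈ᴺ-boundary-even 0 y p∈ (inj₁ refl)
    face-above-left (suc x) y p∈ with ℕ.<-≤-connex (suc y) a₂
    ... | inj₂ a₂≤ = trans (oddFace-top (suc x) (suc y) a₂≤)
                           (∈ᴺ-boundary-even (suc x) y p∈ (top-end (suc x) y p∈ a₂≤))
    ... | inj₁ y+1< = begin
      oddFace (suc x) (suc y)
        ≡⟨ oddFace-inside x y (proj₁ (A₀ᴺ⇒InGrid (suc x , y) p∈)) y+1< ⟩
      (A₀ᴺ (x , y) ∨ A₀ᴺ (suc x , suc y)) xor isEven (x + y)
        ≡⟨ cong₂ (λ b c → (b ∨ c) xor isEven (x + y))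
                 (neighbour∉ᴺ (suc x , y) (x , y) p∈ (inj₂ (refl , inj₂ refl)))
                 (neighbour∉ᴺ (suc x , y) (suc x , suc y) p∈ (inj₁ (refl , inj₁ refl))) ⟩
      isEven (x + y)
        ≡⟨ BoolP.not-involutive _ ⟨
      not (not (isEven (x + y)))
        ≡⟨ cong not (isEven-suc (x + y)) ⟨
      not (isEven (suc x + y))
        ∎
      where open ≡-Reasoning

    WallBelow WallRight WallAbove WallLeft : ℕ → ℕ → Set
    WallBelow x y = oddFace x y ≢ oddFace (suc x) y
    WallRight x y = oddFace (suc x) y ≢ oddFace (suc x) (suc y)
    WallAbove x y = oddFace (suc x) (suc y) ≢ oddFace x (suc y)
    WallLeft  x y = oddFace x (suc y) ≢ oddFace x y

    AllEqual : Bool → Bool → Bool → Bool → Set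
    AllEqual q₀ q₁ q₂ q₃ = q₀ ≡ q₁ × q₁ ≡ q₂ × q₂ ≡ q₃

    -- A point of the wall between odd and even faces: the four faces around
    -- (x , y), listed counterclockwise from the lower left, do not all agree.
    Wall : ℕ × ℕ → Set
    Wall (x , y) = InGrid (x , y) ×
                   ¬ AllEqual (oddFace x y) (oddFace (suc x) y) (oddFace (suc x) (suc y)) (oddFace x (suc y))

    wall⇒∉ᴺ : ∀ x y → Wall (x , y) → A₀ᴺ (x , y) ≡ false
    wall⇒∉ᴺ x y (_ , ¬eq) = BoolP.¬-not λ p∈ →
      ¬eq (trans (face-below-left x y p∈) (sym (face-below-right x y p∈)) ,
           trans (face-below-right x y p∈) (sym (face-above-right x y p∈)) ,
           trans (face-above-right x y p∈) (sym (face-above-left x y p∈)))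

    -- Going once around a vertex, the colour changes an even number of times.
    two-changes : ∀ q₀ q₁ q₂ q₃ → ¬ AllEqual q₀ q₁ q₂ q₃ →
                  (q₀ ≢ q₁ ⊎ q₂ ≢ q₃) × (q₁ ≢ q₂ ⊎ q₃ ≢ q₀) ⊎
                  (q₀ ≢ q₁ × q₂ ≢ q₃) ⊎
                  (q₁ ≢ q₂ × q₃ ≢ q₀)
    two-changes true  true  true  true  ¬eq = ⊥-elim (¬eq (refl , refl , refl))
    two-changes true  true  true  false _   = inj₁ (inj₂ (λ ()) , inj₂ (λ ()))
    two-changes true  true  false true  _   = inj₁ (inj₂ (λ ()) , inj₁ (λ ()))
    two-changes true  true  false false _   = inj₂ (inj₂ ((λ ()) , (λ ())))
    two-changes true  false true  true  _   = inj₁ (inj₁ (λ ()) , inj₁ (λ ()))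
    two-changes true  false true  false _   = inj₁ (inj₁ (λ ()) , inj₁ (λ ()))
    two-changes true  false false true  _   = inj₂ (inj₁ ((λ ()) , (λ ())))
    two-changes true  false false false _   = inj₁ (inj₁ (λ ()) , inj₂ (λ ()))
    two-changes false true  true  true  _   = inj₁ (inj₁ (λ ()) , inj₂ (λ ()))
    two-changes false true  true  false _   = inj₂ (inj₁ ((λ ()) , (λ ())))
    two-changes false true  false true  _   = inj₁ (inj₁ (λ ()) , inj₁ (λ ()))
    two-changes false true  false false _   = inj₁ (inj₁ (λ ()) , inj₁ (λ ()))
    two-changes false false true  true  _   = inj₂ (inj₂ ((λ ()) , (λ ())))
    two-changes false false true  false _   = inj₁ (inj₂ (λ ()) , inj₁ (λ ()))
    two-changes false false false true  _   = inj₁ (inj₂ (λ ()) , inj₂ (λ ()))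
    two-changes false false false false ¬eq = ⊥-elim (¬eq (refl , refl , refl))

    wall-below : ∀ x y → InGrid (x , y) → WallBelow x y →
                 ∃ λ y′ → suc y′ ≡ y × Wall (x , y′)
    wall-below x zero    _          ne = ⊥-elim (ne (oddFace-bottom x))
    wall-below x (suc y) (x< , y<) ne = y , refl , (x< , ℕ.<-trans (ℕ.n<1+n y) y<) , λ (_ , _ , e) → ne (sym e)

    wall-above : ∀ x y → InGrid (x , y) → WallAbove x y → Wall (x , suc y)
    wall-above x y (x< , _) ne with ℕ.<-≤-connex (suc y) a₂
    ... | inj₁ y+1< = (x< , y+1<) , λ (e , _) → ne (sym e)
    ... | inj₂ a₂≤  = ⊥-elim (ne (trans (oddFace-top (suc x) (suc y) a₂≤) (sym (oddFace-top x (suc y) a₂≤))))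

    wall-right : ∀ x y → InGrid (x , y) → WallRight x y → Wall (suc x , y)
    wall-right x y (_ , y<) ne with ℕ.<-≤-connex (suc x) a₁
    ... | inj₁ x+1< = (x+1< , y<) , λ (e₀ , e₁ , e₂) → ne (trans e₀ (trans e₁ e₂))
    ... | inj₂ a₁≤  = ⊥-elim (ne (trans (oddFace-right (suc x) y a₁≤) (sym (oddFace-right (suc x) (suc y) a₁≤))))

    wall-left : ∀ x y → InGrid (x , y) → WallLeft x y →
                ∃ λ x′ → suc x′ ≡ x × Wall (x′ , y)
    wall-left zero    y _          ne = ⊥-elim (ne refl)
    wall-left (suc x) y (x< , y<) ne = x , refl , (ℕ.<-trans (ℕ.n<1+n x) x< , y<) , λ (_ , e , _) → ne (sym e)

    vertical-wall : ∀ x y → InGrid (x , y) → WallBelow x y ⊎ WallAbove x y →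
                    ∃ λ y′ → GridAdj (x , y) (x , y′) × Wall (x , y′)
    vertical-wall x y r (inj₁ ne) with wall-below x y r ne
    ... | y′ , e , w = y′ , inj₁ (refl , inj₂ e) , w
    vertical-wall x y r (inj₂ ne) = suc y , inj₁ (refl , inj₁ refl) , wall-above x y r ne

    horizontal-wall : ∀ x y → InGrid (x , y) → WallRight x y ⊎ WallLeft x y →
                      ∃ λ x′ → x′ ≢ x × GridAdj (x , y) (x′ , y) × Wall (x′ , y)
    horizontal-wall x y r (inj₁ ne) = suc x , ℕ.1+n≢n , inj₂ (refl , inj₁ refl) , wall-right x y r ne
    horizontal-wall x y r (inj₂ ne) with wall-left x y r ne
    ... | x′ , refl , w = x′ , ℕ.1+n≢n ∘ sym , inj₂ (refl , inj₂ refl) , w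

    wall-neighbours : ∀ x y → Wall (x , y) →
                      ∃₂ λ p q → p ≢ q × (GridAdj (x , y) p × Wall p) × (GridAdj (x , y) q × Wall q)
    wall-neighbours x y w@(r , ¬eq) with two-changes _ _ _ _ ¬eq
    ... | inj₁ (vertical , horizontal) with vertical-wall x y r vertical | horizontal-wall x y r horizontal
    ...   | y′ , a , wv | x′ , x′≢x , b , wh = (x , y′) , (x′ , y) , x′≢x ∘ sym ∘ cong proj₁ , (a , wv) , (b , wh)
    wall-neighbours x y w@(r , _) | inj₂ (inj₁ (below , above)) with wall-below x y r below
    ... | y′ , refl , wb = (x , y′) , (x , suc y) , ℕ.<⇒≢ (s≤s (ℕ.n≤1+n y′)) ∘ cong proj₂ ,
                           (inj₁ (refl , inj₂ refl) , wb) , (inj₁ (refl , inj₁ refl) , wall-above x y r above)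
    wall-neighbours x y w@(r , _) | inj₂ (inj₂ (right , left)) with wall-left x y r left
    ... | x′ , refl , wl = (suc x , y) , (x′ , y) , ℕ.<⇒≢ (s≤s (ℕ.n≤1+n x′)) ∘ sym ∘ cong proj₁ ,
                           (inj₂ (refl , inj₁ refl) , wall-right x y r right) , (inj₂ (refl , inj₂ refl) , wl)

    wall-vertex : ∀ {p} → Wall p → V a₁ a₂
    wall-vertex {p} (r , _) = at p r

    at-injective : ∀ {p q} r s → at p r ≡ at q s → p ≡ q
    at-injective {p} {q} r s e = trans (sym (pos-at p r)) (trans (cong pos e) (pos-at q s))

    earlier-wall : ∀ p (w : Wall p) → ∃ λ q → Σ (Wall q) λ w′ → wall-vertex w′ ≺ wall-vertex w
    earlier-wall (x , y) w@(r , _) with wall-neighbours x y w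
    ... | p , q , p≢q , (a , wp@(rp , _)) , (b , wq@(rq , _))
      with one-of-two-earlier (trans (sym (A₀ᴺ-at (x , y) r)) (wall⇒∉ᴺ x y w))
             (Adj-at (x , y) p r rp a) (Adj-at (x , y) q r rq b) (p≢q ∘ at-injective rp rq)
    ... | inj₁ p≺ = p , wp , p≺
    ... | inj₂ q≺ = q , wq , q≺

    no-wall : ∀ p → ¬ Wall p
    no-wall p w = descent (suc (time (wall-vertex w))) p w ℕ.≤-refl
      where
      descent : ∀ t p (w : Wall p) → time (wall-vertex w) < t → ⊥
      descent zero    p w ()
      descent (suc t) p w lt with earlier-wall p w
      ... | q , w′ , lt′ = descent t q w′ (ℕ.<-≤-trans lt′ (ℕ.≤-pred lt))

    -- An odd vertex of A₀ makes the face below-left of it odd, while the face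
    -- at the left end of the same row is even; in between lies a wall point.
    ∈⇒even : ∀ v → v ∈ˢ A₀ → Even v
    ∈⇒even v v∈ with isEven (X v + Y v) in e
    ... | true  = isEven⇒2∣ _ e
    ... | false with first-change (λ i → oddFace i (Y v)) (X v) refl odd-face
      where
      odd-face : oddFace (X v) (Y v) ≡ true
      odd-face = trans (face-below-left (X v) (Y v) (trans (A₀ᴺ-pos v) v∈)) (cong not e)
    ...   | k , k<x , change = ⊥-elim (no-wall (k , Y v) ((ℕ.<-trans k<x (proj₁ (inGrid v)) , proj₂ (inGrid v)) ,
                                                           λ (e₀ , _) → change e₀))

module InfectionTimes {a₁ a₂ : ℕ} (A₀ : VSet a₁ a₂) (percolates : Percolates A₀) where
  open Grid a₁ a₂

  time : V a₁ a₂ → ℕ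
  time v = least (λ t → bootstrap A₀ t v) (proj₁ (percolates v))

  infected-at-time : ∀ v → bootstrap A₀ (time v) v ≡ true
  infected-at-time v = least-true (λ t → bootstrap A₀ t v) (proj₁ (percolates v)) (proj₂ (percolates v))

  healthy-before-time : ∀ v t → t < time v → bootstrap A₀ t v ≡ false
  healthy-before-time v = least-minimal (λ t → bootstrap A₀ t v) (proj₁ (percolates v))

  infected⇒time≤ : ∀ t v → bootstrap A₀ t v ≡ true → time v ≤ t
  infected⇒time≤ t v infected with ℕ.≤-<-connex (time v) t
  ... | inj₁ time≤t = time≤t
  ... | inj₂ t<time = ⊥-elim (false≢true (trans (sym (healthy-before-time v t t<time)) infected))

  ∈⇒time≡0 : ∀ {v} → v ∈ˢ A₀ → time v ≡ 0
  ∈⇒time≡0 {v} v∈ = ℕ.n≤0⇒n≡0 (infected⇒time≤ 0 v v∈)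

  time≡0⇒∈ : ∀ {v} → time v ≡ 0 → v ∈ˢ A₀
  time≡0⇒∈ {v} e = subst (λ t → bootstrap A₀ t v ≡ true) e (infected-at-time v)

  earlier later simultaneous : V a₁ a₂ → ℕ
  earlier v      = ∑ Vs (λ w → bit (adj v w ∧ (time w <ᵇ time v)))
  later v        = ∑ Vs (λ w → bit (adj v w ∧ (time v <ᵇ time w)))
  simultaneous v = ∑ Vs (λ w → bit (adj v w ∧ (time v ≡ᵇ time w)))

  three-earlier : ∀ v → 3 * bit (not (A₀ v)) ≤ earlier v
  three-earlier v with A₀ v in e | time v in et
  ... | true  | _     = z≤n
  ... | false | zero  = ⊥-elim (false≢true (trans (sym e) (time≡0⇒∈ et)))
  ... | false | suc t = ℕ.≤-trans (three-infected-neighbours step-infects) (∑-mono-≤ Vs infected⇒earlier)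
    where
    step-infects : step (bootstrap A₀ t) v ≡ true
    step-infects = subst (λ s → bootstrap A₀ s v ≡ true) et (infected-at-time v)
    three-infected-neighbours : step (bootstrap A₀ t) v ≡ true → 3 ≤ nbrCount (bootstrap A₀ t) v
    three-infected-neighbours s with bootstrap A₀ t v in eb
    ... | true  = ⊥-elim (false≢true (trans (sym (healthy-before-time v t (subst (t <_) (sym et) (ℕ.n<1+n t)))) eb))
    ... | false = ℕ.<ᵇ⇒< 2 _ (≡true⇒T s)
    infected⇒earlier : ∀ w → bit (adj v w ∧ bootstrap A₀ t w) ≤ bit (adj v w ∧ (time w <ᵇ suc t))
    infected⇒earlier w with adj v w | bootstrap A₀ t w in ew
    ... | false | _     = z≤n
    ... | true  | false = z≤n
    ... | true  | true  rewrite T⇒≡true (ℕ.<⇒<ᵇ (s≤s (infected⇒time≤ t w ew))) = ℕ.≤-refl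

  degree-split : ∀ v → degree v ≡ earlier v + later v + simultaneous v
  degree-split v = trans (∑-cong Vs split) (trans (∑-+ Vs _ _) (cong (_+ simultaneous v) (∑-+ Vs _ _)))
    where
    trichotomy : ∀ m n → bit (n <ᵇ m) + bit (m <ᵇ n) + bit (m ≡ᵇ n) ≡ 1
    trichotomy zero    zero    = refl
    trichotomy zero    (suc n) = refl
    trichotomy (suc m) zero    = refl
    trichotomy (suc m) (suc n) = trichotomy m n
    split : ∀ w → bit (adj v w) ≡ bit (adj v w ∧ (time w <ᵇ time v)) + bit (adj v w ∧ (time v <ᵇ time w))
                                    + bit (adj v w ∧ (time v ≡ᵇ time w))
    split w with adj v w
    ... | false = refl
    ... | true  = sym (trichotomy (time v) (time w))

  ∑later≡∑earlier : ∑ Vs later ≡ ∑ Vs earlier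
  ∑later≡∑earlier = trans (∑-swap Vs Vs (λ v w → bit (adj v w ∧ (time v <ᵇ time w))))
    (∑-cong Vs λ w → ∑-cong Vs λ v → cong (λ b → bit (b ∧ (time v <ᵇ time w))) (adj-comm v w))

module Extremal {a₁ a₂ : ℕ} (0<a₁ : 0 < a₁) (0<a₂ : 0 < a₂) (A₀ : VSet a₁ a₂)
                (percolates : Percolates A₀) (size : 3 * card A₀ ≡ a₁ * a₂ + a₁ + a₂) where
  open Grid a₁ a₂
  open InfectionTimes A₀ percolates

  outside : ℕ
  outside = ∑ Vs (λ v → bit (not (A₀ v)))

  card+outside : card A₀ + outside ≡ a₁ * a₂
  card+outside = begin
    card A₀ + outside                                           ≡⟨ ∑-+ Vs (bit ∘ A₀) _ ⟨
    ∑ Vs (λ v → bit (A₀ v) + bit (not (A₀ v)))   ≡⟨ ∑-cong Vs (λ v → one (A₀ v)) ⟩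
    ∑ Vs (λ _ → 1)                                ≡⟨ ∑-vertices-Y (λ _ → 1) ⟩
    a₁ * ∑< a₂ (λ _ → 1)                                        ≡⟨ cong (a₁ *_) (∑<-const a₂ 1) ⟩
    a₁ * (a₂ * 1)                                               ≡⟨ cong (a₁ *_) (ℕ.*-identityʳ a₂) ⟩
    a₁ * a₂                                                     ∎
    where
    open ≡-Reasoning
    one : ∀ b → bit b + bit (not b) ≡ 1
    one true  = refl
    one false = refl

  3·outside : 3 * outside + (a₁ * a₂ + a₁ + a₂) ≡ 3 * (a₁ * a₂)
  3·outside = begin
    3 * outside + (a₁ * a₂ + a₁ + a₂) ≡⟨ cong (3 * outside +_) size ⟨
    3 * outside + 3 * card A₀         ≡⟨ ℕ.+-comm (3 * outside) _ ⟩
    3 * card A₀ + 3 * outside         ≡⟨ ℕ.*-distribˡ-+ 3 (card A₀) outside ⟨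
    3 * (card A₀ + outside)           ≡⟨ cong (3 *_) card+outside ⟩
    3 * (a₁ * a₂)                     ∎
    where open ≡-Reasoning

  ∑gridDegree≡6·outside : ∑ Vs gridDegree ≡ 2 * (3 * outside)
  ∑gridDegree≡6·outside = trans ∑-gridDegree (grid-edges a₁ a₂ outside 0<a₁ 0<a₂ 3·outside)

  ∑degree≡ : ∑ Vs degree ≡
             ∑ Vs earlier + ∑ Vs earlier + ∑ Vs simultaneous
  ∑degree≡ = trans (∑-cong Vs degree-split)
    (trans (∑-+ Vs _ simultaneous)
      (cong (_+ ∑ Vs simultaneous)
        (trans (∑-+ Vs earlier later) (cong (∑ Vs earlier +_) ∑later≡∑earlier))))

  counting-is-tight : ∑ Vs simultaneous ≡ 0 × ∑ Vs earlier ≡ 3 * outside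
  counting-is-tight = double-squeeze lower upper
    where
    open ℕ.≤-Reasoning
    lower : 3 * outside ≤ ∑ Vs earlier
    lower = subst (_≤ ∑ Vs earlier) (∑-*ˡ Vs 3 _)
                  (∑-mono-≤ Vs three-earlier)
    upper : ∑ Vs earlier + ∑ Vs earlier + ∑ Vs simultaneous ≤
            2 * (3 * outside)
    upper = begin
      ∑ Vs earlier + ∑ Vs earlier + ∑ Vs simultaneous
        ≡⟨ ∑degree≡ ⟨
      ∑ Vs degree     ≤⟨ ∑-mono-≤ Vs degree≤gridDegree ⟩
      ∑ Vs gridDegree ≡⟨ ∑gridDegree≡6·outside ⟩
      2 * (3 * outside)             ∎

  simultaneous≡0 : ∀ v → simultaneous v ≡ 0
  simultaneous≡0 v = sym (∑-squeeze Vs {g = simultaneous} (λ _ → z≤n)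
    (ℕ.≤-reflexive (trans (proj₁ counting-is-tight) (sym (∑-zero Vs (λ _ → 0) λ _ _ → refl))))
    (∈-vertices v))

  earlier≡ : ∀ v → earlier v ≡ 3 * bit (not (A₀ v))
  earlier≡ v = sym (∑-squeeze Vs three-earlier
    (ℕ.≤-reflexive (trans (proj₂ counting-is-tight) (sym (∑-*ˡ Vs 3 _)))) (∈-vertices v))

  degree≡gridDegree : ∀ v → degree v ≡ gridDegree v
  degree≡gridDegree v = ∑-squeeze Vs degree≤gridDegree (begin
    ∑ Vs gridDegree  ≡⟨ ∑gridDegree≡6·outside ⟩
    2 * (3 * outside)              ≡⟨ cong (2 *_) (proj₂ counting-is-tight) ⟨
    2 * ∑ Vs earlier ≡⟨ cong (∑ Vs earlier +_) (ℕ.+-identityʳ _) ⟩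
    ∑ Vs earlier + ∑ Vs earlier
      ≤⟨ ℕ.m≤m+n _ (∑ Vs simultaneous) ⟩
    ∑ Vs earlier + ∑ Vs earlier + ∑ Vs simultaneous
      ≡⟨ ∑degree≡ ⟨
    ∑ Vs degree      ∎) (∈-vertices v)
    where open ℕ.≤-Reasoning

  later+3≡gridDegree : ∀ {v} → v ∉ˢ A₀ → later v + 3 ≡ gridDegree v
  later+3≡gridDegree {v} v∉ = begin
    later v + 3
      ≡⟨ ℕ.+-comm (later v) 3 ⟩
    3 + later v
      ≡⟨ ℕ.+-identityʳ _ ⟨
    3 * bit (not false) + later v + 0
      ≡⟨ cong₂ (λ b s → 3 * bit (not b) + later v + s) v∉ (simultaneous≡0 v) ⟨
    3 * bit (not (A₀ v)) + later v + simultaneous v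
      ≡⟨ cong (λ e → e + later v + simultaneous v) (earlier≡ v) ⟨
    earlier v + later v + simultaneous v
      ≡⟨ degree-split v ⟨
    degree v
      ≡⟨ degree≡gridDegree v ⟩
    gridDegree v
      ∎
    where open ≡-Reasoning

  later-indicator : ∀ {v w} → LaterNeighbour time v w → bit (adj v w ∧ (time v <ᵇ time w)) ≡ 1
  later-indicator {v} {w} (v~w , v≺w) rewrite v~w | T⇒≡true (ℕ.<⇒<ᵇ v≺w) = refl

  1≤later : ∀ {v w} → LaterNeighbour time v w → 1 ≤ later v
  1≤later {v} {w} l = subst (_≤ later v) (later-indicator l) (∈⇒≤∑ _ (∈-vertices w))

  later-bound : ∀ {v k} → v ∉ˢ A₀ → k ≤ later v → gridDegree v < k + 3 → ⊥
  later-bound {v} {k} v∉ k≤later degree<k+3 = ℕ.<-irrefl refl (begin-strict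
    gridDegree v <⟨ degree<k+3 ⟩
    k + 3        ≤⟨ ℕ.+-monoˡ-≤ 3 k≤later ⟩
    later v + 3  ≡⟨ later+3≡gridDegree v∉ ⟩
    gridDegree v ∎)
    where open ℕ.≤-Reasoning

  schedule : ExtremalSchedule A₀
  schedule = record
    { time            = time
    ; time≡0⇒∈        = time≡0⇒∈
    ; ∈⇒time≡0        = ∈⇒time≡0
    ; Adj⇒time≢       = distinct-times
    ; later-unique    = later-unique
    ; interior-later  = interior-later
    ; boundary-latest = λ {v} v∉ bd l → later-bound v∉ (1≤later l) (s≤s (gridDegree-boundary v bd))
    ; corner∈         = λ {v} c → BoolP.¬-not λ v∉ → later-bound v∉ z≤n (s≤s (gridDegree-corner v c))
    }
    where
    distinct-times : ∀ {u w} → Adj u w → time u ≢ time w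
    distinct-times {u} {w} u~w e =
      ℕ.1+n≰n (ℕ.≤-trans (subst (_≤ simultaneous u) one (∈⇒≤∑ _ (∈-vertices w))) (ℕ.≤-reflexive (simultaneous≡0 u)))
      where
      one : bit (adj u w ∧ (time u ≡ᵇ time w)) ≡ 1
      one rewrite u~w | T⇒≡true (ℕ.≡⇒≡ᵇ _ _ e) = refl

    later-unique : ∀ {v w₁ w₂} → v ∉ˢ A₀ → LaterNeighbour time v w₁ → LaterNeighbour time v w₂ → w₁ ≡ w₂
    later-unique {v} {w₁} {w₂} v∉ l₁ l₂ with ≡-dec Fin._≟_ Fin._≟_ w₁ w₂
    ... | yes w₁≡w₂ = w₁≡w₂
    ... | no  w₁≢w₂ = ⊥-elim (later-bound v∉ two (s≤s (gridDegree≤4 v)))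
      where
      two : 2 ≤ later v
      two = subst (_≤ later v) (cong₂ _+_ (later-indicator l₁) (later-indicator l₂))
                  (∈₂⇒≤∑ _ (∈-vertices w₁) (∈-vertices w₂) w₁≢w₂)

    interior-later : ∀ {v} → v ∉ˢ A₀ → ¬ Boundary v → ∃ (LaterNeighbour time v)
    interior-later {v} v∉ ¬bd with ∑-pos⇒∃ Vs _ 0<later
      where
      0<later : 0 < later v
      0<later = ℕ.+-cancelʳ-≤ 3 1 (later v)
                  (ℕ.≤-trans (gridDegree-interior v ¬bd) (ℕ.≤-reflexive (sym (later+3≡gridDegree v∉))))
    ... | w , _ , indicator with to T-∧ (≡true⇒T (bit-pos indicator))
    ...   | v~w , v≺w = w , T⇒≡true v~w , ℕ.<ᵇ⇒< _ _ v≺w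

lemma3p3 : (a₁ a₂ : ℕ) → 2 ≤ a₁ → 2 ≤ a₂ → (A₀ : VSet a₁ a₂) →
    3 * card A₀ ≡ a₁ * a₂ + a₁ + a₂ → Percolates A₀ →
    Independent A₀
    × ((v : V a₁ a₂) → Boundary v → Even v → v ∈ˢ A₀)
    × (OddNat a₁ × OddNat a₂)
    × ((u : V a₁ a₂) → u ∈ˢ compl A₀ →
         CompIsTree (compl A₀) u × CompOneBoundary (compl A₀) u)
    × ((v : V a₁ a₂) → v ∈ˢ A₀ → Even v)
lemma3p3 a₁ a₂ 2≤a₁ 2≤a₂ A₀ size percolates =
  independent ,
  boundary-even⇒∈ ,
  sides-odd ,
  (λ u u∈ → component-is-tree u , one-boundary-vertex u u∈) ,
  ∈⇒even
  where
  0<a₁ : 0 < a₁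
  0<a₁ = ℕ.≤-trans (s≤s z≤n) 2≤a₁
  0<a₂ : 0 < a₂
  0<a₂ = ℕ.≤-trans (s≤s z≤n) 2≤a₂
  open Consequences (Extremal.schedule 0<a₁ 0<a₂ A₀ percolates size)
  open Parity 0<a₁ 0<a₂
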